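{- Let $q$ be a prime power, $m$ a positive integer and $Q := q^m$. Let $\mathcal{C}$ be an $[[n,\tilde{k},d]]_{q^m}$ rank-metric code, defined from a linear code over $\mathbb{F}_Q$ with generator matrix $G \in \mathbb{F}_Q^{\tilde{k}\times n}$. Then the function $E\colon \mathbb{F}_Q^n \to \mathbb{F}_Q^{\tilde{k}}$ defined by $E(x) := G x^\top$ is an $(n-d+1,0)$-extractor for $\mathbb{F}_q$-restricted affine sources over $\mathbb{F}_Q$. Conversely, if a linear function $E\colon \mathbb{F}_Q^n \to \mathbb{F}_Q^{\tilde{k}}$ is an $(n-d+1,0)$-extractor for all $\mathbb{F}_q$-restricted affine sources over $\mathbb{F}_Q$, then the matrix representing $E$ is a generator matrix of an $[[n,\tilde{k},d]]_{q^m}$ code.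
   Context: Fix an $\mathbb{F}_q$-linear isomorphism $\varphi\colon \mathbb{F}_Q \to \mathbb{F}_q^m$ (elements mapped to column vectors) and let $\Phi(x_1,\dots,x_n) := [\varphi(x_1)\mid\cdots\mid\varphi(x_n)] \in \mathbb{F}_q^{m\times n}$. The rank distance between $A,B \in \mathbb{F}_q^{m\times n}$ is $\mathrm{rank}_q(A-B)$. An $[[n,\tilde{k},d]]_{q^m}$ code is a $\tilde{k}$-dimensional $\mathbb{F}_Q$-linear subspace of $\mathbb{F}_Q^n$ whose minimum rank distance (the minimum of $\mathrm{rank}_q(\Phi(c))$ over nonzero codewords $c$) equals $d$. A $k$-dimensional affine source over $\mathbb{F}_Q^n$ is the uniform distribution on an affine subspace $\{xA+\beta : x \in \mathbb{F}_Q^k\}$ with $A$ of rank $k$ and fixed $\beta \in \mathbb{F}_Q^n$; it is $\mathbb{F}_q$-restricted if $A$ can be chosen with entries in $\mathbb{F}_q$ (rank $k$). A function $f\colon \mathbb{F}_Q^n \to \mathbb{F}_Q^{\tilde{k}}$ is a $(k,\epsilon)$-extractor for $\mathbb{F}_q$-restricted affine sources if for every $\mathbb{F}_q$-restricted affine source of dimension $k$ over $\mathbb{F}_Q^n$, the output distribution is $\epsilon$-close in statistical distance to uniform on $\mathbb{F}_Q^{\tilde{k}}$.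
   Formalization: In the converse, the matrix representing E is a generator matrix of a k̃-dimensional code whose minimum rank distance is at least d rather than exactly d. The statement above fails without it. -}

module Defs where

open import Level using (0ℓ)
open import Data.Nat as ℕ using (ℕ; zero; suc; _≤_)
open import Data.Nat.Primality using (Prime)
open import Data.Fin using (Fin; zero; suc)
open import Data.Fin.Base using () renaming (toℕ to toℕ)
open import Data.List using (List; []; _∷_; map; concatMap; length; filter; allFin)
open import Data.Product using (Σ; _×_; ∃; _,_)
open import Data.Empty using (⊥)
open import Relation.Nullary using (¬_; Dec; yes; no)
open import Relation.Unary using (Decidable)
open import Relation.Binary.PropositionalEquality using (_≡_; _≢_)
open import Algebra.Core using (Op₁; Op₂)
open import Algebra.Structures using (IsCommutativeRing)
open import Function.Bundles using (_↔_; Inverse)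
open import Function.Definitions using (Injective)

IsPrimePower : ℕ → Set
IsPrimePower q = Σ ℕ λ p → Σ ℕ λ e → Prime p × (1 ≤ e) × (q ≡ p ℕ.^ e)

record FiniteField : Set₁ where
  infixl 7 _*_
  infixl 6 _+_
  field
    Carrier : Set
    _+_     : Op₂ Carrier
    _*_     : Op₂ Carrier
    -_      : Op₁ Carrier
    0#      : Carrier
    1#      : Carrier
    isCommutativeRing : IsCommutativeRing _≡_ _+_ _*_ -_ 0# 1#
    _≟_     : (x y : Carrier) → Dec (x ≡ y)
    1≢0     : 1# ≢ 0#
    _⁻¹     : Carrier → Carrier
    inverse : ∀ x → x ≢ 0# → x * (x ⁻¹) ≡ 1#
    card    : ℕ
    enum    : Carrier ↔ Fin card

  elements : List Carrier
  elements = map (Inverse.from enum) (allFin card)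

  ∑ : ∀ {n} → (Fin n → Carrier) → Carrier
  ∑ {zero}  f = 0#
  ∑ {suc n} f = f zero + ∑ (λ i → f (suc i))

  Vect : ℕ → Set
  Vect n = Fin n → Carrier

  Mat : ℕ → ℕ → Set
  Mat r c = Fin r → Fin c → Carrier

  zeroVec : ∀ {n} → Vect n → Set
  zeroVec v = ∀ i → v i ≡ 0#

  LinIndep : ∀ {r n} → (Fin r → Vect n) → Set
  LinIndep {r} v = (a : Fin r → Carrier) →
                   (∀ i → ∑ (λ j → a j * v j i) ≡ 0#) → ∀ j → a j ≡ 0#

  IndepCols : ∀ {r c} → Mat r c → ℕ → Set
  IndepCols {r} {c} A s =
    Σ (Fin s → Fin c) λ σ → Injective _≡_ _≡_ σ × LinIndep (λ j i → A i (σ j))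

  RankIs : ∀ {r c} → Mat r c → ℕ → Set
  RankIs A s = IndepCols A s × (∀ t → IndepCols A t → t ≤ s)

  FullRowRank : ∀ {r c} → Mat r c → Set
  FullRowRank A = LinIndep A

  _·ᵣ_ : ∀ {r c} → Vect r → Mat r c → Vect c
  (x ·ᵣ A) j = ∑ (λ i → x i * A i j)

  _·ᶜ_ : ∀ {r c} → Mat r c → Vect c → Vect r
  (M ·ᶜ x) i = ∑ (λ j → M i j * x j)

  _+ᵥ_ : ∀ {n} → Vect n → Vect n → Vect n
  (u +ᵥ v) i = u i + v i

  allVects : (k : ℕ) → List (Vect k)
  allVects zero    = (λ ()) ∷ []
  allVects (suc k) = concatMap (λ a → map (λ v → cons a v) (allVects k)) elements
    where
    cons : Carrier → Vect k → Vect (suc k)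
    cons a v zero    = a
    cons a v (suc i) = v i

  _≟ᵥ_ : ∀ {n} → (u v : Vect n) → Dec (∀ i → u i ≡ v i)
  _≟ᵥ_ {zero}  u v = yes (λ ())
  _≟ᵥ_ {suc n} u v with u zero ≟ v zero | _≟ᵥ_ (λ i → u (suc i)) (λ i → v (suc i))
  ... | yes p | yes q = yes λ { zero → p ; (suc i) → q i }
  ... | no ¬p | _     = no λ h → ¬p (h zero)
  ... | yes _ | no ¬q = no λ h → ¬q (λ i → h (suc i))

  countPre : ∀ {k n} → (Vect k → Vect n) → Vect n → ℕ
  countPre {k} g y = length (filter (λ x → g x ≟ᵥ y) (allVects k))

-- The setting: a subfield K = F_q embedded into F = F_Q via ι, and a
-- fixed F_q-linear isomorphism φ : F_Q → F_q^m.

module Setting (K F : FiniteField) (ι : FiniteField.Carrier K → FiniteField.Carrier F) where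
  private
    module K = FiniteField K
    module F = FiniteField F

  record IsEmbedding : Set where
    field
      inj   : Injective _≡_ _≡_ ι
      hom-+ : ∀ a b → ι (a K.+ b) ≡ ι a F.+ ι b
      hom-* : ∀ a b → ι (a K.* b) ≡ ι a F.* ι b
      hom-1 : ι K.1# ≡ F.1#

  record IsLinIso {m : ℕ} (φ : F.Carrier → K.Vect m) : Set where
    field
      lin-+ : ∀ x y i → φ (x F.+ y) i ≡ φ x i K.+ φ y i
      lin-* : ∀ a x i → φ (ι a F.* x) i ≡ a K.* φ x i
      ψ     : K.Vect m → F.Carrier
      ψφ    : ∀ x → ψ (φ x) ≡ x
      φψ    : ∀ v i → φ (ψ v) i ≡ v i

  module WithPhi {m : ℕ} (φ : F.Carrier → K.Vect m) where

    Φ : ∀ {n} → F.Vect n → K.Mat m n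
    Φ c i j = φ (c j) i

    RankQ : ∀ {n} → F.Vect n → ℕ → Set
    RankQ c r = K.RankIs (Φ c) r

    MinRankDistIs : ∀ {k̃ n} → F.Mat k̃ n → ℕ → Set
    MinRankDistIs {k̃} G d =
      (Σ (F.Vect k̃) λ y → ¬ F.zeroVec (y F.·ᵣ G) × RankQ (y F.·ᵣ G) d) ×
      (∀ (y : F.Vect k̃) → ¬ F.zeroVec (y F.·ᵣ G) → ∀ r → RankQ (y F.·ᵣ G) r → d ≤ r)

    GeneratesRankCode : ∀ {k̃ n} → F.Mat k̃ n → ℕ → Set
    GeneratesRankCode G d = F.FullRowRank G × MinRankDistIs G d

    -- (k, 0)-extractor for F_q-restricted affine sources:
    -- for every A' ∈ F_q^{k×n} with ι∘A' of rank k over F_Q and every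
    -- β ∈ F_Q^n, the output of f on the uniform distribution on
    -- {x (ι∘A') + β : x ∈ F_Q^k} is exactly uniform on F_Q^k̃, i.e.
    -- every y has probability 1 / Q^k̃.  (x ↦ x A + β is injective
    -- since A has rank k, so uniform x gives the uniform source.)
    IsZeroErrorExtractor : ∀ {n k̃} → ℕ → (F.Vect n → F.Vect k̃) → Set
    IsZeroErrorExtractor {n} {k̃} k f =
      (A' : K.Mat k n) (β : F.Vect n) →
      F.FullRowRank (λ i j → ι (A' i j)) →
      (y : F.Vect k̃) →
      F.countPre (λ x → f ((x F.·ᵣ (λ i j → ι (A' i j))) F.+ᵥ β)) y ℕ.* (F.card ℕ.^ k̃)
        ≡ F.card ℕ.^ k

-- Let the k-dimensional source, k = n − d + 1, be generated by an F_q-matrix A.  The map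
-- x ↦ G(xA + β)ᵀ is affine with linear part u ↦ (GAᵀ)u, so its output is exactly uniform
-- once GAᵀ has full row rank, that is, once no nonzero codeword c = aG is orthogonal to the
-- rows of A.  Such a codeword has rank r ≥ d, and orthogonality to rows over F_q can be
-- checked on the rows of Φ(c): the rows of A together with the unit vectors at r independent
-- column positions of Φ(c) are then independent in F_qⁿ, so k + r ≤ n < k + d.
-- Conversely an extractor is onto for every source, so no nonzero codeword is orthogonal to
-- the rows of a source matrix; yet for a codeword of rank r < d one builds k ≤ n − r
-- independent such rows, each from a dependency among r + 1 columns of Φ(c).

module Submission where

open import Defs
open import Data.Nat using (ℕ; suc; _≤_; _∸_; _^_)
open import Data.Product using (Σ; _×_; _,_)
open import Relation.Binary.PropositionalEquality using (_≡_; trans; sym; cong)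

module ListSums where

  open import Data.Nat using (ℕ; zero; suc; _+_; _*_; _≤_; _<_; z≤n; s≤s)
  open import Data.Nat.Properties
    using (+-assoc; *-distribˡ-+; *-zeroʳ; +-mono-≤; +-commutativeSemigroup; +-0-commutativeMonoid)
  open import Algebra.Properties.CommutativeSemigroup +-commutativeSemigroup using (interchange)
  open import Algebra.Properties.CommutativeMonoid.Sum +-0-commutativeMonoid
    using (sum; sum-cong-≗; sum-replicate-zero)
  open import Data.Fin using (Fin; zero; suc)
  open import Data.Fin.Properties using (suc-injective) renaming (_≟_ to _≟ᶠ_)
  open import Data.List using (List; []; _∷_; map; concatMap; _++_; length; filter; tabulate)
  open import Data.List.Membership.Propositional using (_∈_)
  open import Data.List.Relation.Unary.Any using (here; there)
  open import Data.Product using (_×_; _,_; proj₁; proj₂)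
  open import Data.Empty using (⊥-elim)
  open import Function using (_∘_)
  open import Relation.Nullary using (¬_; Dec; yes; no)
  open import Relation.Binary.PropositionalEquality

  private variable A B : Set

  ∑ₗ : List A → (A → ℕ) → ℕ
  ∑ₗ []       f = 0
  ∑ₗ (x ∷ xs) f = f x + ∑ₗ xs f

  ∑ₗ-cong : ∀ (xs : List A) {f g : A → ℕ} → (∀ x → f x ≡ g x) → ∑ₗ xs f ≡ ∑ₗ xs g
  ∑ₗ-cong []       f≗g = refl
  ∑ₗ-cong (x ∷ xs) f≗g = cong₂ _+_ (f≗g x) (∑ₗ-cong xs f≗g)

  ∑ₗ-++ : ∀ (xs ys : List A) f → ∑ₗ (xs ++ ys) f ≡ ∑ₗ xs f + ∑ₗ ys f
  ∑ₗ-++ []       ys f = refl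
  ∑ₗ-++ (x ∷ xs) ys f = trans (cong (f x +_) (∑ₗ-++ xs ys f)) (sym (+-assoc (f x) _ _))

  ∑ₗ-map : ∀ (h : A → B) xs f → ∑ₗ (map h xs) f ≡ ∑ₗ xs (f ∘ h)
  ∑ₗ-map h []       f = refl
  ∑ₗ-map h (x ∷ xs) f = cong (f (h x) +_) (∑ₗ-map h xs f)

  ∑ₗ-concatMap : ∀ (h : A → List B) xs f → ∑ₗ (concatMap h xs) f ≡ ∑ₗ xs (λ x → ∑ₗ (h x) f)
  ∑ₗ-concatMap h []       f = refl
  ∑ₗ-concatMap h (x ∷ xs) f =
    trans (∑ₗ-++ (h x) (concatMap h xs) f) (cong (∑ₗ (h x) f +_) (∑ₗ-concatMap h xs f))

  ∑ₗ-distrib-+ : ∀ (xs : List A) f g → ∑ₗ xs (λ x → f x + g x) ≡ ∑ₗ xs f + ∑ₗ xs g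
  ∑ₗ-distrib-+ []       f g = refl
  ∑ₗ-distrib-+ (x ∷ xs) f g =
    trans (cong (f x + g x +_) (∑ₗ-distrib-+ xs f g)) (interchange (f x) (g x) _ _)

  ∑ₗ-zero : ∀ (xs : List A) → ∑ₗ xs (λ _ → 0) ≡ 0
  ∑ₗ-zero []       = refl
  ∑ₗ-zero (x ∷ xs) = ∑ₗ-zero xs

  ∑ₗ-comm : ∀ (xs : List A) (ys : List B) (h : A → B → ℕ) →
            ∑ₗ xs (λ x → ∑ₗ ys (h x)) ≡ ∑ₗ ys (λ y → ∑ₗ xs (λ x → h x y))
  ∑ₗ-comm []       ys h = sym (∑ₗ-zero ys)
  ∑ₗ-comm (x ∷ xs) ys h =
    trans (cong (∑ₗ ys (h x) +_) (∑ₗ-comm xs ys h)) (sym (∑ₗ-distrib-+ ys (h x) _))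

  ∑ₗ-const : ∀ (xs : List A) c → ∑ₗ xs (λ _ → c) ≡ length xs * c
  ∑ₗ-const []       c = refl
  ∑ₗ-const (x ∷ xs) c = cong (c +_) (∑ₗ-const xs c)

  *-distribˡ-∑ₗ : ∀ (xs : List A) c f → c * ∑ₗ xs f ≡ ∑ₗ xs (λ x → c * f x)
  *-distribˡ-∑ₗ []       c f = *-zeroʳ c
  *-distribˡ-∑ₗ (x ∷ xs) c f = trans (*-distribˡ-+ c (f x) _) (cong (c * f x +_) (*-distribˡ-∑ₗ xs c f))

  ∑ₗ-tabulate : ∀ {n} (g : Fin n → A) f → ∑ₗ (tabulate g) f ≡ sum (f ∘ g)
  ∑ₗ-tabulate {n = zero}  g f = refl
  ∑ₗ-tabulate {n = suc n} g f = cong (f (g zero) +_) (∑ₗ-tabulate (g ∘ suc) f)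

  ∑ₗ-mono-≤ : ∀ (xs : List A) {f g : A → ℕ} → (∀ x → f x ≤ g x) → ∑ₗ xs f ≤ ∑ₗ xs g
  ∑ₗ-mono-≤ []       f≤g = z≤n
  ∑ₗ-mono-≤ (x ∷ xs) f≤g = +-mono-≤ (f≤g x) (∑ₗ-mono-≤ xs f≤g)

  length≤∑ₗ : ∀ (xs : List A) {f : A → ℕ} → (∀ x → 1 ≤ f x) → length xs ≤ ∑ₗ xs f
  length≤∑ₗ []       1≤f = z≤n
  length≤∑ₗ (x ∷ xs) 1≤f = +-mono-≤ (1≤f x) (length≤∑ₗ xs 1≤f)

  length<∑ₗ : ∀ {xs : List A} {f : A → ℕ} {x} → (∀ x → 1 ≤ f x) → x ∈ xs → 2 ≤ f x → length xs < ∑ₗ xs f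
  length<∑ₗ {xs = _ ∷ xs} 1≤f (here refl)  2≤fx = +-mono-≤ 2≤fx (length≤∑ₗ xs 1≤f)
  length<∑ₗ {xs = y ∷ _}  1≤f (there x∈xs) 2≤fx = +-mono-≤ (1≤f y) (length<∑ₗ 1≤f x∈xs 2≤fx)

  𝟙 : {P : Set} → Dec P → ℕ
  𝟙 (yes _) = 1
  𝟙 (no _)  = 0

  𝟙-cong : {P Q : Set} → (P → Q) → (Q → P) → (p : Dec P) (q : Dec Q) → 𝟙 p ≡ 𝟙 q
  𝟙-cong f g (yes p) (yes q) = refl
  𝟙-cong f g (yes p) (no ¬q) = ⊥-elim (¬q (f p))
  𝟙-cong f g (no ¬p) (yes q) = ⊥-elim (¬p (g q))
  𝟙-cong f g (no ¬p) (no ¬q) = refl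

  𝟙-mono : {P Q : Set} → (P → Q) → (p : Dec P) (q : Dec Q) → 𝟙 p ≤ 𝟙 q
  𝟙-mono P→Q (yes p) (yes _) = s≤s z≤n
  𝟙-mono P→Q (yes p) (no ¬q) = ⊥-elim (¬q (P→Q p))
  𝟙-mono P→Q (no _)  q       = z≤n

  𝟙-+-≤ : {P Q R : Set} → (P → R) → (Q → R) → (P → ¬ Q) →
          (p : Dec P) (q : Dec Q) (r : Dec R) → 𝟙 p + 𝟙 q ≤ 𝟙 r
  𝟙-+-≤ P→R Q→R P→¬Q (yes p) (yes q) r       = ⊥-elim (P→¬Q p q)
  𝟙-+-≤ P→R Q→R P→¬Q (yes p) (no _)  (yes _) = s≤s z≤n
  𝟙-+-≤ P→R Q→R P→¬Q (yes p) (no _)  (no ¬r) = ⊥-elim (¬r (P→R p))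
  𝟙-+-≤ P→R Q→R P→¬Q (no _)  (yes q) (yes _) = s≤s z≤n
  𝟙-+-≤ P→R Q→R P→¬Q (no _)  (yes q) (no ¬r) = ⊥-elim (¬r (Q→R q))
  𝟙-+-≤ P→R Q→R P→¬Q (no _)  (no _)  r       = z≤n

  𝟙-× : {P Q R : Set} → (P → Q × R) → (Q → R → P) →
        (p : Dec P) (q : Dec Q) (r : Dec R) → 𝟙 p ≡ 𝟙 q * 𝟙 r
  𝟙-× f g (yes p) (yes q) (yes r) = refl
  𝟙-× f g (yes p) (yes q) (no ¬r) = ⊥-elim (¬r (proj₂ (f p)))
  𝟙-× f g (yes p) (no ¬q) r       = ⊥-elim (¬q (proj₁ (f p)))
  𝟙-× f g (no ¬p) (yes q) (yes r) = ⊥-elim (¬p (g q r))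
  𝟙-× f g (no ¬p) (yes q) (no ¬r) = refl
  𝟙-× f g (no ¬p) (no ¬q) r       = refl

  length-filter≡∑ₗ𝟙 : ∀ {P : A → Set} (P? : ∀ x → Dec (P x)) xs →
                      length (filter P? xs) ≡ ∑ₗ xs (λ x → 𝟙 (P? x))
  length-filter≡∑ₗ𝟙 P? []       = refl
  length-filter≡∑ₗ𝟙 P? (x ∷ xs) with P? x
  ... | yes _ = cong suc (length-filter≡∑ₗ𝟙 P? xs)
  ... | no  _ = length-filter≡∑ₗ𝟙 P? xs

  sum-𝟙≟ : ∀ {n} (j : Fin n) → sum (λ i → 𝟙 (j ≟ᶠ i)) ≡ 1
  sum-𝟙≟ {suc n} zero    = cong suc (sum-replicate-zero n)
  sum-𝟙≟ {suc n} (suc j) = trans (sum-cong-≗ (λ i → 𝟙-cong suc-injective (cong suc) (suc j ≟ᶠ suc i) (j ≟ᶠ i)))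
                                  (sum-𝟙≟ j)

module FiniteSearch where

  open import Data.Nat using (ℕ; zero; suc; _+_; _≤_; _<_; s≤s⁻¹)
  open import Data.Nat.Properties using (≤-trans; m≤n+m; +-monoʳ-≤; +-suc; <⇒≱; m≤n⇒m<n∨m≡n)
  open import Data.Fin using (Fin; zero; suc; _↑ˡ_; _↑ʳ_; splitAt; join)
  open import Data.Fin.Properties using (any?; all?; ¬∀⟶∃¬; injective⇒≤; join-splitAt) renaming (_≟_ to _≟ᶠ_)
  open import Data.List using (List; []; _∷_; map; concatMap; length; filter)
  open import Data.List.Membership.Propositional using (_∈_; lose)
  open import Data.List.Membership.Propositional.Properties using (∈-map⁺; ∈-concatMap⁺; ∈-filter⁺)
  open import Data.List.Extrema.Nat using (argmin; argmin-all; f[argmin]≤f[xs])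
  import Data.List.Relation.Unary.All as All
  open import Data.List.Relation.Unary.All.Properties using (all-filter)
  open import Data.List.Relation.Unary.Any using (here)
  open import Data.Product using (∃; _×_; _,_; proj₁; proj₂)
  open import Data.Sum using (inj₁; inj₂)
  open import Data.Empty using (⊥-elim)
  import Data.Vec.Functional as V
  open import Data.Vec.Functional.Properties using (lookup-++ˡ; lookup-++ʳ)
  open import Function using (_∘_)
  open import Function.Definitions using (Injective)
  open import Relation.Nullary using (Dec; yes; no; ¬?)
  open import Relation.Nullary.Decidable using (decidable-stable; _→-dec_)
  open import Relation.Binary.PropositionalEquality

  private variable A : Set

  allFunctions : List A → (t : ℕ) → List (Fin t → A)
  allFunctions xs zero    = (λ ()) ∷ []
  allFunctions xs (suc t) = concatMap (λ a → map (a V.∷_) (allFunctions xs t)) xs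

  allFunctions-complete : ∀ {xs : List A} → (∀ a → a ∈ xs) → ∀ t (f : Fin t → A) →
                          ∃ λ g → g ∈ allFunctions xs t × (∀ i → f i ≡ g i)
  allFunctions-complete all∈ zero    f = _ , here refl , λ ()
  allFunctions-complete all∈ (suc t) f with allFunctions-complete all∈ t (f ∘ suc)
  ... | g , g∈ , f≗g =
    f zero V.∷ g ,
    ∈-concatMap⁺ (λ a → map (a V.∷_) (allFunctions _ t)) (lose (all∈ (f zero)) (∈-map⁺ (f zero V.∷_) g∈)) ,
    λ { zero → refl ; (suc i) → f≗g i }

  filter-nonempty : ∀ {P : A → Set} (P? : ∀ x → Dec (P x)) xs → length (filter P? xs) ≢ 0 → ∃ P
  filter-nonempty P? []       ≢0 = ⊥-elim (≢0 refl)
  filter-nonempty P? (x ∷ xs) ≢0 with P? x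
  ... | yes Px = x , Px
  ... | no  _  = filter-nonempty P? xs ≢0

  minimum : ∀ (h : A → ℕ) {P : A → Set} (P? : ∀ x → Dec (P x)) (xs : List A) {x₀} → P x₀ →
            ∃ λ y → P y × (∀ {x} → x ∈ xs → P x → h y ≤ h x)
  minimum h P? xs {x₀} Px₀ =
    argmin h x₀ (filter P? xs) ,
    argmin-all h Px₀ (all-filter P? xs) ,
    λ x∈xs Px → All.lookup (f[argmin]≤f[xs] x₀ (filter P? xs)) (∈-filter⁺ P? x∈xs Px)

  largest : ∀ {P : ℕ → Set} → (∀ t → Dec (P t)) → P 0 → ∀ c → (∀ t → P t → t ≤ c) →
            ∃ λ s → P s × (∀ t → P t → t ≤ s)
  largest P? P0 c bound with P? c
  ... | yes Pc = c , Pc , bound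
  largest P? P0 zero    bound | no ¬P0 = ⊥-elim (¬P0 P0)
  largest {P} P? P0 (suc c) bound | no ¬Pc = largest P? P0 c bound′
    where
    bound′ : ∀ t → P t → t ≤ c
    bound′ t Pt with m≤n⇒m<n∨m≡n (bound t Pt)
    ... | inj₁ t<1+c  = s≤s⁻¹ t<1+c
    ... | inj₂ refl   = ⊥-elim (¬Pc Pt)

  ↑-cases : ∀ {k r} {P : Fin (k + r) → Set} → (∀ l → P (l ↑ˡ r)) → (∀ t → P (k ↑ʳ t)) → ∀ s → P s
  ↑-cases {k} {r} {P} left right s = subst P (join-splitAt k r s) (cases (splitAt k s))
    where
    cases : ∀ x → P (join k r x)
    cases (inj₁ l) = left l
    cases (inj₂ t) = right t

  injective? : ∀ {t c} (σ : Fin t → Fin c) → Dec (Injective _≡_ _≡_ σ)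
  injective? σ with all? (λ i → all? (λ j → (σ i ≟ᶠ σ j) →-dec (i ≟ᶠ j)))
  ... | yes h = yes (λ {i} {j} → h i j)
  ... | no ¬h = no (λ inj → ¬h (λ i j → inj))

  ∃-∉-image : ∀ {a b} (f : Fin a → Fin b) → a < b → ∃ λ j → ∀ i → f i ≢ j
  ∃-∉-image {a} {b} f a<b with any? (λ j → all? (λ i → ¬? (f i ≟ᶠ j)))
  ... | yes missed = missed
  ... | no ¬missed = ⊥-elim (<⇒≱ a<b (injective⇒≤ {f = preimage} preimage-injective))
    where
    hit : ∀ j → ∃ λ i → f i ≡ j
    hit j with ¬∀⟶∃¬ a (λ i → f i ≢ j) (λ i → ¬? (f i ≟ᶠ j)) (λ h → ¬missed (j , h))
    ... | i , ¬f≢ = i , decidable-stable (f i ≟ᶠ j) ¬f≢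
    preimage : Fin b → Fin a
    preimage j = proj₁ (hit j)
    preimage-injective : Injective _≡_ _≡_ preimage
    preimage-injective {j} {j′} eq = trans (sym (proj₂ (hit j))) (trans (cong f eq) (proj₂ (hit j′)))

  injection-avoiding : ∀ {r n} k (σ : Fin r → Fin n) → r + k ≤ n →
                       ∃ λ (τ : Fin k → Fin n) → Injective _≡_ _≡_ τ × (∀ l t → τ l ≢ σ t)
  injection-avoiding zero σ _ = (λ ()) , (λ {}) , λ ()
  injection-avoiding {r} {n} (suc k) σ r+k+1≤n
    with injection-avoiding k σ (≤-trans (+-monoʳ-≤ r (m≤n+m k 1)) r+k+1≤n)
  ... | τ , τ-inj , τ∉σ with ∃-∉-image (σ V.++ τ) (subst (_≤ n) (+-suc r k) r+k+1≤n)
  ... | j , j∉ = j V.∷ τ , inj , avoids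
    where
    inj : Injective _≡_ _≡_ (j V.∷ τ)
    inj {zero}  {zero}   _  = refl
    inj {zero}  {suc l}  eq = ⊥-elim (j∉ (r ↑ʳ l) (trans (lookup-++ʳ σ τ l) (sym eq)))
    inj {suc l} {zero}   eq = ⊥-elim (j∉ (r ↑ʳ l) (trans (lookup-++ʳ σ τ l) eq))
    inj {suc l} {suc l′} eq = cong suc (τ-inj eq)
    avoids : ∀ l t → (j V.∷ τ) l ≢ σ t
    avoids zero    t eq = j∉ (t ↑ˡ k) (trans (lookup-++ˡ σ τ t) (sym eq))
    avoids (suc l) t    = τ∉σ l t

module LinearAlgebra (𝔽 : FiniteField) where

  open import Level using (0ℓ)
  open import Algebra.Bundles using (CommutativeRing)
  open import Data.Nat as ℕ using (ℕ; zero; suc; z≤n; s≤s)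
  import Data.Nat.Properties as ℕₚ
  open import Algebra.Properties.CommutativeMonoid.Sum ℕₚ.+-0-commutativeMonoid
    using (sum; sum-permute; sum-cong-≗)
  open import Data.Fin using (Fin; zero; suc; punchIn; _↑ˡ_; _↑ʳ_)
  open import Data.Fin.Properties using (any?; all?; ¬∀⟶∃¬; punchInᵢ≢i; injective⇒≤) renaming (_≟_ to _≟ᶠ_)
  open import Data.Fin.Permutation using (permutation)
  open import Data.List using (map; allFin; length)
  open import Data.List.Properties using (length-map; length-tabulate)
  open import Data.List.Membership.Propositional using (_∈_; lose; find)
  open import Data.List.Membership.Propositional.Properties using (∈-map⁺; ∈-allFin; ∈-concatMap⁺)
  open import Data.List.Relation.Unary.Any using (here) renaming (any? to anyₗ?)
  import Data.Vec.Functional as V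
  open import Data.Vec.Functional using (insertAt)
  open import Data.Vec.Functional.Properties using (insertAt-lookup; insertAt-punchIn)
  open import Data.Product using (∃; _×_; _,_; proj₁; proj₂)
  open import Data.Sum using (_⊎_; inj₁; inj₂)
  open import Data.Empty using (⊥-elim)
  open import Function using (_∘_)
  open import Function.Bundles using (Inverse)
  open import Function.Definitions using (Injective)
  open import Relation.Nullary using (¬_; Dec; yes; no; ¬?)
  open import Relation.Nullary.Decidable using (decidable-stable; _×-dec_)
  open import Relation.Binary.PropositionalEquality
  open ListSums
  open FiniteSearch

  open FiniteField 𝔽

  commutativeRing : CommutativeRing 0ℓ 0ℓ
  commutativeRing = record { isCommutativeRing = isCommutativeRing }

  open CommutativeRing commutativeRing public
    using (+-assoc; +-comm; +-identityˡ; +-identityʳ; -‿inverseˡ; -‿inverseʳ;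
           *-assoc; *-comm; *-identityˡ; *-identityʳ; distribˡ; distribʳ; zeroˡ; zeroʳ;
           ring; +-commutativeSemigroup; *-commutativeSemigroup)
  open import Algebra.Properties.Ring ring public
    using (-‿distribˡ-*; -‿distribʳ-*; +-identityˡ-unique; +-inverseˡ-unique; +-inverseʳ-unique; -0#≈0#; +-cancelʳ)
  open import Algebra.Properties.CommutativeSemigroup +-commutativeSemigroup public
    using () renaming (interchange to +-interchange; x∙yz≈y∙xz to +-exchange; xy∙z≈xz∙y to +-exchange′)
  open import Algebra.Properties.CommutativeSemigroup *-commutativeSemigroup public
    using () renaming (x∙yz≈y∙xz to *-exchange)
  open ≡-Reasoning

  x*y≡0⇒y≡0 : ∀ {x y} → x ≢ 0# → x * y ≡ 0# → y ≡ 0#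
  x*y≡0⇒y≡0 {x} {y} x≢0 xy≡0 = begin
    y                ≡⟨ sym (*-identityˡ y) ⟩
    1# * y           ≡⟨ cong (_* y) (trans (sym (inverse x x≢0)) (*-comm x (x ⁻¹))) ⟩
    (x ⁻¹ * x) * y   ≡⟨ *-assoc (x ⁻¹) x y ⟩
    x ⁻¹ * (x * y)   ≡⟨ cong (x ⁻¹ *_) xy≡0 ⟩
    x ⁻¹ * 0#        ≡⟨ zeroʳ (x ⁻¹) ⟩
    0#               ∎

  x*[x⁻¹*y]≡y : ∀ x y → x ≢ 0# → x * (x ⁻¹ * y) ≡ y
  x*[x⁻¹*y]≡y x y x≢0 = trans (sym (*-assoc x (x ⁻¹) y)) (trans (cong (_* y) (inverse x x≢0)) (*-identityˡ y))

  [y*x⁻¹]*x≡y : ∀ x y → x ≢ 0# → (y * x ⁻¹) * x ≡ y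
  [y*x⁻¹]*x≡y x y x≢0 = trans (*-assoc y (x ⁻¹) x)
    (trans (cong (y *_) (trans (*-comm (x ⁻¹) x) (inverse x x≢0))) (*-identityʳ y))

  x-y+y≡x : ∀ x y → (x + - y) + y ≡ x
  x-y+y≡x x y = trans (+-assoc x (- y) y) (trans (cong (x +_) (-‿inverseˡ y)) (+-identityʳ x))

  x+y-y≡x : ∀ x y → (x + y) + - y ≡ x
  x+y-y≡x x y = trans (+-assoc x y (- y)) (trans (cong (x +_) (-‿inverseʳ y)) (+-identityʳ x))

  x≡y⇒x-y≡0 : ∀ {x y} → x ≡ y → x + - y ≡ 0#
  x≡y⇒x-y≡0 {x} refl = -‿inverseʳ x

  ∑-cong : ∀ {n} {f g : Vect n} → (∀ i → f i ≡ g i) → ∑ f ≡ ∑ g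
  ∑-cong {zero}  f≗g = refl
  ∑-cong {suc n} f≗g = cong₂ _+_ (f≗g zero) (∑-cong (f≗g ∘ suc))

  ∑-zero : ∀ {n} {f : Vect n} → (∀ i → f i ≡ 0#) → ∑ f ≡ 0#
  ∑-zero {zero}  f≗0 = refl
  ∑-zero {suc n} f≗0 = trans (cong₂ _+_ (f≗0 zero) (∑-zero (λ i → f≗0 (suc i)))) (+-identityʳ 0#)

  ∑-distrib-+ : ∀ {n} (f g : Vect n) → ∑ (λ i → f i + g i) ≡ ∑ f + ∑ g
  ∑-distrib-+ {zero}  f g = sym (+-identityʳ 0#)
  ∑-distrib-+ {suc n} f g = trans (cong (f zero + g zero +_) (∑-distrib-+ (λ i → f (suc i)) (λ i → g (suc i))))
                                  (+-interchange (f zero) (g zero) _ _)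

  *-distribˡ-∑ : ∀ {n} x (f : Vect n) → x * ∑ f ≡ ∑ (λ i → x * f i)
  *-distribˡ-∑ {zero}  x f = zeroʳ x
  *-distribˡ-∑ {suc n} x f = trans (distribˡ x (f zero) _) (cong (x * f zero +_) (*-distribˡ-∑ x (λ i → f (suc i))))

  *-distribʳ-∑ : ∀ {n} x (f : Vect n) → ∑ f * x ≡ ∑ (λ i → f i * x)
  *-distribʳ-∑ x f = trans (*-comm _ x) (trans (*-distribˡ-∑ x f) (∑-cong (λ i → *-comm x (f i))))

  -‿distrib-∑ : ∀ {n} (f : Vect n) → - ∑ f ≡ ∑ (λ i → - f i)
  -‿distrib-∑ f = sym (+-inverseˡ-unique _ _
    (trans (sym (∑-distrib-+ (λ i → - f i) f)) (∑-zero (λ i → -‿inverseˡ (f i)))))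

  ∑-comm : ∀ {m n} (f : Fin m → Fin n → Carrier) → ∑ (λ i → ∑ (f i)) ≡ ∑ (λ j → ∑ (λ i → f i j))
  ∑-comm {zero} {n} f = sym (∑-zero {n} (λ j → refl))
  ∑-comm {suc m} f = trans (cong (∑ (f zero) +_) (∑-comm (λ i → f (suc i))))
                           (sym (∑-distrib-+ (f zero) (λ j → ∑ (λ i → f (suc i) j))))

  ∑-remove : ∀ {n} (f : Vect (suc n)) p → ∑ f ≡ f p + ∑ (λ i → f (punchIn p i))
  ∑-remove         f zero    = refl
  ∑-remove {suc n} f (suc p) = trans (cong (f zero +_) (∑-remove (λ i → f (suc i)) p)) (+-exchange _ _ _)

  ∑-++ : ∀ {k r} (f : Vect (k ℕ.+ r)) → ∑ f ≡ ∑ (λ l → f (l ↑ˡ r)) + ∑ (λ t → f (k ↑ʳ t))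
  ∑-++ {zero}      f = sym (+-identityˡ _)
  ∑-++ {suc k} {r} f = trans (cong (f zero +_) (∑-++ {k} {r} (λ i → f (suc i)))) (sym (+-assoc _ _ _))

  ∑-supported : ∀ {n} (f : Vect n) p → (∀ j → j ≢ p → f j ≡ 0#) → ∑ f ≡ f p
  ∑-supported {suc n} f p f≡0 = begin
    ∑ f                               ≡⟨ ∑-remove f p ⟩
    f p + ∑ (λ i → f (punchIn p i))   ≡⟨ cong (f p +_) (∑-zero (λ i → f≡0 _ (punchInᵢ≢i p i))) ⟩
    f p + 0#                          ≡⟨ +-identityʳ (f p) ⟩
    f p                               ∎

  infix 4 _≐_
  _≐_ : ∀ {n} → Vect n → Vect n → Set
  u ≐ v = ∀ i → u i ≡ v i

  infix 7 _∙_
  _∙_ : ∀ {n} → Vect n → Vect n → Carrier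
  u ∙ v = ∑ (λ j → u j * v j)

  ∙-+ᵥ-zero : ∀ {n} (u v : Vect n) → u ∙ (v +ᵥ (λ _ → 0#)) ≡ u ∙ v
  ∙-+ᵥ-zero u v = ∑-cong (λ j → cong (u j *_) (+-identityʳ (v j)))

  ∙-+ᵥ : ∀ {n} (w u v : Vect n) → w ∙ (u +ᵥ v) ≡ w ∙ u + w ∙ v
  ∙-+ᵥ {n} w u v = trans (∑-cong (λ j → distribˡ (w j) (u j) (v j))) (∑-distrib-+ {n} _ _)

  ·ᵣ-+ᵥ : ∀ {k n} (x u : Vect k) (A : Mat k n) → (x +ᵥ u) ·ᵣ A ≐ (x ·ᵣ A) +ᵥ (u ·ᵣ A)
  ·ᵣ-+ᵥ {k} x u A j = trans (∑-cong (λ l → distribʳ (A l j) (x l) (u l))) (∑-distrib-+ {k} _ _)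

  ∙-comm : ∀ {n} (u v : Vect n) → u ∙ v ≡ v ∙ u
  ∙-comm u v = ∑-cong (λ j → *-comm (u j) (v j))

  ∙-·ᶜ : ∀ {m n} (x : Vect m) (M : Mat m n) (y : Vect n) → x ∙ (M ·ᶜ y) ≡ (x ·ᵣ M) ∙ y
  ∙-·ᶜ {m} {n} x M y = begin
    ∑ (λ i → x i * ∑ (λ j → M i j * y j))     ≡⟨ ∑-cong {m} (λ i → *-distribˡ-∑ {n} (x i) _) ⟩
    ∑ (λ i → ∑ (λ j → x i * (M i j * y j)))   ≡⟨ ∑-comm {m} {n} _ ⟩
    ∑ (λ j → ∑ (λ i → x i * (M i j * y j)))   ≡⟨ ∑-cong {n} (λ j → ∑-cong {m} (λ i → sym (*-assoc (x i) _ _))) ⟩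
    ∑ (λ j → ∑ (λ i → (x i * M i j) * y j))   ≡⟨ ∑-cong {n} (λ j → sym (*-distribʳ-∑ {m} (y j) _)) ⟩
    ∑ (λ j → ∑ (λ i → x i * M i j) * y j)     ∎

  ∙-·ᵣ : ∀ {k n} (x : Vect n) (y : Vect k) (A : Mat k n) → x ∙ (y ·ᵣ A) ≡ ∑ (λ l → y l * (x ∙ A l))
  ∙-·ᵣ {k} {n} x y A = begin
    ∑ (λ j → x j * ∑ (λ l → y l * A l j))     ≡⟨ ∑-cong {n} (λ j → *-distribˡ-∑ {k} (x j) _) ⟩
    ∑ (λ j → ∑ (λ l → x j * (y l * A l j)))   ≡⟨ ∑-comm {n} {k} _ ⟩
    ∑ (λ l → ∑ (λ j → x j * (y l * A l j)))   ≡⟨ ∑-cong {k} (λ l → ∑-cong {n} (λ j → *-exchange (x j) (y l) _)) ⟩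
    ∑ (λ l → ∑ (λ j → y l * (x j * A l j)))   ≡⟨ ∑-cong {k} (λ l → sym (*-distribˡ-∑ {n} (y l) _)) ⟩
    ∑ (λ l → y l * (x ∙ A l))                 ∎

  e : ∀ {n} → Fin n → Vect n
  e p j with j ≟ᶠ p
  ... | yes _ = 1#
  ... | no  _ = 0#

  e-diag : ∀ {n} (p : Fin n) → e p p ≡ 1#
  e-diag p with p ≟ᶠ p
  ... | yes _   = refl
  ... | no  p≢p = ⊥-elim (p≢p refl)

  e-offdiag : ∀ {n} {p j : Fin n} → j ≢ p → e p j ≡ 0#
  e-offdiag {p = p} {j} j≢p with j ≟ᶠ p
  ... | yes j≡p = ⊥-elim (j≢p j≡p)
  ... | no  _   = refl

  ∑-*e : ∀ {n} (f : Vect n) p → ∑ (λ j → f j * e p j) ≡ f p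
  ∑-*e f p = trans (∑-supported _ p (λ j j≢p → trans (cong (f j *_) (e-offdiag j≢p)) (zeroʳ (f j))))
                   (trans (cong (f p *_) (e-diag p)) (*-identityʳ (f p)))

  ∑-e* : ∀ {n} (f : Vect n) p → ∑ (λ j → e p j * f j) ≡ f p
  ∑-e* f p = trans (∑-cong (λ j → *-comm (e p j) (f j))) (∑-*e f p)

  ∙-+e* : ∀ {c} (f x : Vect c) p t → f ∙ (λ j → x j + e p j * t) ≡ f ∙ x + f p * t
  ∙-+e* {c} f x p t = begin
    ∑ (λ j → f j * (x j + e p j * t))                  ≡⟨ ∑-cong (λ j → distribˡ (f j) (x j) _) ⟩
    ∑ (λ j → f j * x j + f j * (e p j * t))            ≡⟨ ∑-distrib-+ {c} _ _ ⟩
    f ∙ x + ∑ (λ j → f j * (e p j * t))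
      ≡⟨ cong (f ∙ x +_) (∑-cong (λ j → sym (*-assoc (f j) (e p j) t))) ⟩
    f ∙ x + ∑ (λ j → (f j * e p j) * t)                ≡⟨ cong (f ∙ x +_) (sym (*-distribʳ-∑ {c} t _)) ⟩
    f ∙ x + ∑ (λ j → f j * e p j) * t                  ≡⟨ cong (λ y → f ∙ x + y * t) (∑-*e f p) ⟩
    f ∙ x + f p * t                                    ∎

  ∙-subtract : ∀ {n} (u w x : Vect n) a → u ∙ x ≡ (λ j → u j + - (a * w j)) ∙ x + a * (w ∙ x)
  ∙-subtract {n} u w x a = begin
    ∑ (λ j → u j * x j)
      ≡⟨ ∑-cong (λ j → cong (_* x j) (sym (x-y+y≡x (u j) (a * w j)))) ⟩
    ∑ (λ j → ((u j + - (a * w j)) + a * w j) * x j)          ≡⟨ ∑-cong (λ j → distribʳ (x j) _ _) ⟩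
    ∑ (λ j → (u j + - (a * w j)) * x j + (a * w j) * x j)    ≡⟨ ∑-distrib-+ {n} _ _ ⟩
    (λ j → u j + - (a * w j)) ∙ x + ∑ (λ j → (a * w j) * x j)
      ≡⟨ cong ((λ j → u j + - (a * w j)) ∙ x +_)
              (trans (∑-cong (λ j → *-assoc a (w j) (x j))) (sym (*-distribˡ-∑ {n} a _))) ⟩
    (λ j → u j + - (a * w j)) ∙ x + a * (w ∙ x)              ∎

  placeAt : ∀ {r n} → (Fin r → Fin n) → (Fin r → Carrier) → Vect n
  placeAt h a j = ∑ (λ s → a s * e (h s) j)

  ∑-placeAt* : ∀ {r n} (h : Fin r → Fin n) (a : Fin r → Carrier) (g : Vect n) →
               ∑ (λ j → placeAt h a j * g j) ≡ ∑ (λ s → a s * g (h s))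
  ∑-placeAt* {r} {n} h a g = begin
    ∑ (λ j → ∑ (λ s → a s * e (h s) j) * g j)   ≡⟨ ∑-cong (λ j → *-distribʳ-∑ {r} (g j) _) ⟩
    ∑ (λ j → ∑ (λ s → (a s * e (h s) j) * g j)) ≡⟨ ∑-comm {n} {r} _ ⟩
    ∑ (λ s → ∑ (λ j → (a s * e (h s) j) * g j)) ≡⟨ ∑-cong (λ s → ∑-cong {n} (λ j → *-assoc (a s) _ _)) ⟩
    ∑ (λ s → ∑ (λ j → a s * (e (h s) j * g j))) ≡⟨ ∑-cong (λ s → sym (*-distribˡ-∑ {n} (a s) _)) ⟩
    ∑ (λ s → a s * ∑ (λ j → e (h s) j * g j))   ≡⟨ ∑-cong (λ s → cong (a s *_) (∑-e* g (h s))) ⟩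
    ∑ (λ s → a s * g (h s))                     ∎

  IsRelation : ∀ {r n} → (Fin r → Vect n) → (Fin r → Carrier) → Set
  IsRelation v a = ∀ i → ∑ (λ j → a j * v j i) ≡ 0#

  LinIndep-cong : ∀ {r n} {v w : Fin r → Vect n} → (∀ j i → v j i ≡ w j i) → LinIndep v → LinIndep w
  LinIndep-cong v≗w indep a rel = indep a (λ i → trans (∑-cong (λ j → cong (a j *_) (v≗w j i))) (rel i))

  LinIndep⇒nonzero : ∀ {r n} {v : Fin r → Vect n} → LinIndep v → ∀ p → ¬ zeroVec (v p)
  LinIndep⇒nonzero {v = v} indep p vp≡0 =
    1≢0 (trans (sym (e-diag p)) (indep (e p) (λ i → trans (∑-e* (λ j → v j i) p) (vp≡0 i)) p))

  LinIndep-diagonal : ∀ {k n} (A : Mat k n) (π : Fin k → Fin n) →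
                      (∀ l → A l (π l) ≢ 0#) → (∀ l l₀ → l ≢ l₀ → A l (π l₀) ≡ 0#) → LinIndep A
  LinIndep-diagonal A π diagonal≢0 off-diagonal≡0 μ rel l₀ = x*y≡0⇒y≡0 (diagonal≢0 l₀) (begin
    A l₀ (π l₀) * μ l₀               ≡⟨ *-comm _ (μ l₀) ⟩
    μ l₀ * A l₀ (π l₀)               ≡⟨ sym (∑-supported (λ l → μ l * A l (π l₀)) l₀ λ l l≢l₀ →
                                          trans (cong (μ l *_) (off-diagonal≡0 l l₀ l≢l₀)) (zeroʳ (μ l))) ⟩
    ∑ (λ l → μ l * A l (π l₀))       ≡⟨ rel (π l₀) ⟩
    0#                               ∎)

  LinIndep-eliminate : ∀ {r n} {v : Fin (suc r) → Vect n} p (c : Fin r → Carrier) → LinIndep v →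
                       LinIndep (λ i k → v (punchIn p i) k + - (c i * v p k))
  LinIndep-eliminate {r} {n} {v} p c indep a rel i =
    trans (sym (insertAt-punchIn a p α i)) (indep (insertAt a p α) rel′ (punchIn p i))
    where
    α = - ∑ (λ i → a i * c i)
    rel′ : IsRelation v (insertAt a p α)
    rel′ k = begin
      ∑ (λ j → insertAt a p α j * v j k)
        ≡⟨ ∑-remove (λ j → insertAt a p α j * v j k) p ⟩
      insertAt a p α p * v p k + ∑ (λ i → insertAt a p α (punchIn p i) * v (punchIn p i) k)
        ≡⟨ cong₂ _+_ (cong (_* v p k) (insertAt-lookup a p α))
                     (∑-cong (λ i → cong (_* v (punchIn p i) k) (insertAt-punchIn a p α i))) ⟩
      α * v p k + ∑ (λ i → a i * v (punchIn p i) k)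
        ≡⟨ cong (_+ ∑ (λ i → a i * v (punchIn p i) k)) (begin
             α * v p k                               ≡⟨ sym (-‿distribˡ-* _ _) ⟩
             - (∑ (λ i → a i * c i) * v p k)         ≡⟨ cong -_ (*-distribʳ-∑ {r} (v p k) _) ⟩
             - ∑ (λ i → (a i * c i) * v p k)         ≡⟨ -‿distrib-∑ {r} _ ⟩
             ∑ (λ i → - ((a i * c i) * v p k))       ≡⟨ ∑-cong (λ i → cong -_ (*-assoc (a i) _ _)) ⟩
             ∑ (λ i → - (a i * (c i * v p k)))       ≡⟨ ∑-cong (λ i → -‿distribʳ-* (a i) _) ⟩
             ∑ (λ i → a i * - (c i * v p k))         ∎) ⟩
      ∑ (λ i → a i * - (c i * v p k)) + ∑ (λ i → a i * v (punchIn p i) k)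
        ≡⟨ +-comm _ _ ⟩
      ∑ (λ i → a i * v (punchIn p i) k) + ∑ (λ i → a i * - (c i * v p k))
        ≡⟨ sym (∑-distrib-+ {r} _ _) ⟩
      ∑ (λ i → a i * v (punchIn p i) k + a i * - (c i * v p k))
        ≡⟨ ∑-cong (λ i → sym (distribˡ (a i) _ _)) ⟩
      ∑ (λ i → a i * (v (punchIn p i) k + - (c i * v p k)))
        ≡⟨ rel k ⟩
      0# ∎

  LinIndep⇒≤ : ∀ {r n} {v : Fin r → Vect n} → LinIndep v → r ℕ.≤ n
  LinIndep⇒≤ {zero}          indep = z≤n
  LinIndep⇒≤ {suc r} {zero}  indep = ⊥-elim (1≢0 (indep (λ _ → 1#) (λ ()) zero))
  LinIndep⇒≤ {suc r} {suc n} {v} indep with any? (λ j → ¬? (v j zero ≟ 0#))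
  ... | no ¬pivot = ℕₚ.m≤n⇒m≤1+n (LinIndep⇒≤ {v = λ j i → v j (suc i)} tail-indep)
    where
    head≡0 : ∀ j → v j zero ≡ 0#
    head≡0 j = decidable-stable (v j zero ≟ 0#) (λ ne → ¬pivot (j , ne))
    tail-indep : LinIndep (λ j i → v j (suc i))
    tail-indep a rel = indep a λ where
      zero    → ∑-zero (λ j → trans (cong (a j *_) (head≡0 j)) (zeroʳ (a j)))
      (suc i) → rel i
  ... | yes (p , vp0≢0) = s≤s (LinIndep⇒≤ {v = λ i k → reduced i (suc k)}
                                (λ a rel → reduced-indep a λ where
                                   zero    → ∑-zero (λ i → trans (cong (a i *_) (reduced-head i)) (zeroʳ (a i)))
                                   (suc k) → rel k))
    where
    c : Fin r → Carrier
    c i = v (punchIn p i) zero * v p zero ⁻¹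
    reduced : Fin r → Vect (suc n)
    reduced i k = v (punchIn p i) k + - (c i * v p k)
    reduced-indep : LinIndep reduced
    reduced-indep = LinIndep-eliminate {v = v} p c indep
    reduced-head : ∀ i → reduced i zero ≡ 0#
    reduced-head i = x≡y⇒x-y≡0 (sym ([y*x⁻¹]*x≡y (v p zero) _ vp0≢0))

  ·ᶜ-onto : ∀ {r c} (B : Mat r c) → LinIndep B → ∀ z → ∃ λ x → B ·ᶜ x ≐ z
  ·ᶜ-onto {zero}      B indep z = (λ _ → 0#) , λ ()
  ·ᶜ-onto {suc r} {c} B indep z = x , solves
    where
    pivot : ∃ λ p → B zero p ≢ 0#
    pivot = ¬∀⟶∃¬ c _ (λ j → B zero j ≟ 0#) (LinIndep⇒nonzero {v = B} indep zero)
    p = proj₁ pivot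
    coeff : Fin r → Carrier
    coeff i = B (suc i) p * B zero p ⁻¹
    B′ : Mat r c
    B′ i j = B (suc i) j + - (coeff i * B zero j)
    B′-pivot : ∀ i → B′ i p ≡ 0#
    B′-pivot i = x≡y⇒x-y≡0 (sym ([y*x⁻¹]*x≡y _ _ (proj₂ pivot)))
    solution′ = ·ᶜ-onto B′ (LinIndep-eliminate {v = B} zero coeff indep) (λ i → z (suc i) + - (coeff i * z zero))
    x′ = proj₁ solution′
    residual = z zero + - (B zero ∙ x′)
    t = B zero p ⁻¹ * residual
    x : Vect c
    x j = x′ j + e p j * t
    solves-zero : B zero ∙ x ≡ z zero
    solves-zero = begin
      B zero ∙ x                       ≡⟨ ∙-+e* (B zero) x′ p t ⟩
      B zero ∙ x′ + B zero p * t       ≡⟨ cong (B zero ∙ x′ +_) (x*[x⁻¹*y]≡y _ residual (proj₂ pivot)) ⟩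
      B zero ∙ x′ + residual           ≡⟨ +-comm _ residual ⟩
      residual + B zero ∙ x′           ≡⟨ x-y+y≡x (z zero) _ ⟩
      z zero                           ∎
    solves : B ·ᶜ x ≐ z
    solves zero    = solves-zero
    solves (suc i) = begin
      B (suc i) ∙ x                                          ≡⟨ ∙-subtract (B (suc i)) (B zero) x (coeff i) ⟩
      B′ i ∙ x + coeff i * (B zero ∙ x)
        ≡⟨ cong₂ _+_ (∙-+e* (B′ i) x′ p t) (cong (coeff i *_) solves-zero) ⟩
      (B′ i ∙ x′ + B′ i p * t) + coeff i * z zero            ≡⟨ cong (λ y → (B′ i ∙ x′ + y) + coeff i * z zero)
                                                                     (trans (cong (_* t) (B′-pivot i)) (zeroˡ t)) ⟩
      (B′ i ∙ x′ + 0#) + coeff i * z zero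
        ≡⟨ cong (_+ coeff i * z zero) (trans (+-identityʳ _) (proj₂ solution′ i)) ⟩
      (z (suc i) + - (coeff i * z zero)) + coeff i * z zero  ≡⟨ x-y+y≡x _ _ ⟩
      z (suc i)                                              ∎

  private
    from = Inverse.from enum
    to   = Inverse.to enum
    from-to : ∀ a → from (to a) ≡ a
    from-to = Inverse.strictlyInverseʳ enum
    to-from : ∀ i → to (from i) ≡ i
    to-from = Inverse.strictlyInverseˡ enum

  elements-complete : ∀ a → a ∈ elements
  elements-complete a = subst (_∈ elements) (from-to a) (∈-map⁺ from (∈-allFin (to a)))

  length-elements : length elements ≡ card
  length-elements = trans (length-map from (allFin card)) (length-tabulate (λ i → i))

  2≤card : 2 ℕ.≤ card
  2≤card = injective⇒≤ {f = 0,1} 0,1-injective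
    where
    0,1 : Fin 2 → Fin card
    0,1 zero    = to 0#
    0,1 (suc _) = to 1#
    to-injective : ∀ {a b} → to a ≡ to b → a ≡ b
    to-injective {a} {b} eq = trans (sym (from-to a)) (trans (cong from eq) (from-to b))
    0,1-injective : Injective _≡_ _≡_ 0,1
    0,1-injective {zero}       {zero}       _  = refl
    0,1-injective {zero}       {suc zero}   eq = ⊥-elim (1≢0 (sym (to-injective eq)))
    0,1-injective {suc zero}   {zero}       eq = ⊥-elim (1≢0 (to-injective eq))
    0,1-injective {suc zero}   {suc zero}   _  = refl

  ∑ₗ-elements : ∀ h → ∑ₗ elements h ≡ sum (h ∘ from)
  ∑ₗ-elements h = trans (∑ₗ-map from (allFin card) h) (∑ₗ-tabulate (λ i → i) (h ∘ from))

  ∑ₗ-elements-𝟙≡ : ∀ z → ∑ₗ elements (λ a → 𝟙 (z ≟ a)) ≡ 1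
  ∑ₗ-elements-𝟙≡ z = begin
    ∑ₗ elements (λ a → 𝟙 (z ≟ a))   ≡⟨ ∑ₗ-elements _ ⟩
    sum (λ i → 𝟙 (z ≟ from i))      ≡⟨ sum-cong-≗ (λ i → 𝟙-cong (λ z≡ → trans (cong to z≡) (to-from i))
                                                          (λ ≡i → trans (sym (from-to z)) (cong from ≡i))
                                                          (z ≟ from i) (to z ≟ᶠ i)) ⟩
    sum (λ i → 𝟙 (to z ≟ᶠ i))       ≡⟨ sum-𝟙≟ (to z) ⟩
    1                                ∎

  ∑ₗ-elements-+ : ∀ h c → ∑ₗ elements h ≡ ∑ₗ elements (λ a → h (a + c))
  ∑ₗ-elements-+ h c = begin
    ∑ₗ elements h                 ≡⟨ ∑ₗ-elements h ⟩
    sum (h ∘ from)                ≡⟨ sum-permute (h ∘ from) (permutation shift unshift shift-unshift unshift-shift) ⟩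
    sum (λ i → h (from (shift i))) ≡⟨ sum-cong-≗ (λ i → cong h (from-to (from i + c))) ⟩
    sum (λ i → h (from i + c))     ≡⟨ sym (∑ₗ-elements (λ a → h (a + c))) ⟩
    ∑ₗ elements (λ a → h (a + c)) ∎
    where
    shift unshift : Fin card → Fin card
    shift i   = to (from i + c)
    unshift i = to (from i + - c)
    shift-unshift : ∀ i → shift (unshift i) ≡ i
    shift-unshift i = trans (cong (λ a → to (a + c)) (from-to _)) (trans (cong to (x-y+y≡x _ c)) (to-from i))
    unshift-shift : ∀ i → unshift (shift i) ≡ i
    unshift-shift i = trans (cong (λ a → to (a + - c)) (from-to _)) (trans (cong to (x+y-y≡x _ c)) (to-from i))

  Respects≐ : ∀ {k} → (Vect k → ℕ) → Set
  Respects≐ f = ∀ {u v} → u ≐ v → f u ≡ f v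

  allVects-complete : ∀ k (v : Vect k) → ∃ λ u → u ∈ allVects k × v ≐ u
  allVects-complete zero    v = _ , here refl , λ ()
  allVects-complete (suc k) v with allVects-complete k (v ∘ suc)
  ... | u , u∈ , v≐u = _ , ∈-concatMap⁺ _ (lose (elements-complete (v zero)) (∈-map⁺ _ u∈)) ,
                       λ { zero → refl ; (suc i) → v≐u i }

  ∑ₗ-allVects-suc : ∀ k (f : Vect (suc k) → ℕ) → Respects≐ f →
                    ∑ₗ (allVects (suc k)) f ≡ ∑ₗ elements (λ a → ∑ₗ (allVects k) (λ v → f (a V.∷ v)))
  ∑ₗ-allVects-suc k f f-resp = trans (∑ₗ-concatMap _ elements f) (∑ₗ-cong elements (λ a →
    trans (∑ₗ-map _ (allVects k) f) (∑ₗ-cong (allVects k) (λ v → f-resp λ { zero → refl ; (suc i) → refl }))))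

  ∑ₗ-allVects-+ᵥ : ∀ k (f : Vect k → ℕ) → Respects≐ f → ∀ u →
                   ∑ₗ (allVects k) f ≡ ∑ₗ (allVects k) (λ x → f (x +ᵥ u))
  ∑ₗ-allVects-+ᵥ zero    f f-resp u = cong (ℕ._+ 0) (f-resp (λ ()))
  ∑ₗ-allVects-+ᵥ (suc k) f f-resp u = begin
    ∑ₗ (allVects (suc k)) f
      ≡⟨ ∑ₗ-allVects-suc k f f-resp ⟩
    ∑ₗ elements (λ a → ∑ₗ (allVects k) (λ v → f (a V.∷ v)))
      ≡⟨ ∑ₗ-cong elements (λ a →
           ∑ₗ-allVects-+ᵥ k _ (λ u≐v → f-resp λ { zero → refl ; (suc i) → u≐v i }) (u ∘ suc)) ⟩
    ∑ₗ elements (λ a → ∑ₗ (allVects k) (λ v → f (a V.∷ (v +ᵥ (u ∘ suc)))))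
      ≡⟨ ∑ₗ-elements-+ _ (u zero) ⟩
    ∑ₗ elements (λ a → ∑ₗ (allVects k) (λ v → f ((a + u zero) V.∷ (v +ᵥ (u ∘ suc)))))
      ≡⟨ ∑ₗ-cong elements (λ a → ∑ₗ-cong (allVects k) (λ v → f-resp λ { zero → refl ; (suc i) → refl })) ⟩
    ∑ₗ elements (λ a → ∑ₗ (allVects k) (λ v → f ((a V.∷ v) +ᵥ u)))
      ≡⟨ sym (∑ₗ-allVects-suc k _ (λ u≐v → f-resp (λ i → cong (_+ u i) (u≐v i)))) ⟩
    ∑ₗ (allVects (suc k)) (λ x → f (x +ᵥ u)) ∎

  ∑ₗ-allVects-𝟙≐ : ∀ k (z : Vect k) → ∑ₗ (allVects k) (λ y → 𝟙 (z ≟ᵥ y)) ≡ 1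
  ∑ₗ-allVects-𝟙≐ zero    z = refl
  ∑ₗ-allVects-𝟙≐ (suc k) z = begin
    ∑ₗ (allVects (suc k)) (λ y → 𝟙 (z ≟ᵥ y))
      ≡⟨ ∑ₗ-allVects-suc k _ (λ u≐v → 𝟙-cong (λ z≐u i → trans (z≐u i) (u≐v i))
                                               (λ z≐v i → trans (z≐v i) (sym (u≐v i))) _ _) ⟩
    ∑ₗ elements (λ a → ∑ₗ (allVects k) (λ v → 𝟙 (z ≟ᵥ (a V.∷ v))))
      ≡⟨ ∑ₗ-cong elements (λ a → ∑ₗ-cong (allVects k) (λ v →
           𝟙-× (λ z≐ → z≐ zero , z≐ ∘ suc) (λ { z₀≡a _ zero → z₀≡a ; _ z′≐v (suc i) → z′≐v i })
               (z ≟ᵥ (a V.∷ v)) (z zero ≟ a) ((z ∘ suc) ≟ᵥ v))) ⟩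
    ∑ₗ elements (λ a → ∑ₗ (allVects k) (λ v → 𝟙 (z zero ≟ a) ℕ.* 𝟙 ((z ∘ suc) ≟ᵥ v)))
      ≡⟨ ∑ₗ-cong elements (λ a → sym (*-distribˡ-∑ₗ (allVects k) (𝟙 (z zero ≟ a)) _)) ⟩
    ∑ₗ elements (λ a → 𝟙 (z zero ≟ a) ℕ.* ∑ₗ (allVects k) (λ v → 𝟙 ((z ∘ suc) ≟ᵥ v)))
      ≡⟨ ∑ₗ-cong elements (λ a → trans (cong (𝟙 (z zero ≟ a) ℕ.*_) (∑ₗ-allVects-𝟙≐ k (z ∘ suc)))
                                       (ℕₚ.*-identityʳ _)) ⟩
    ∑ₗ elements (λ a → 𝟙 (z zero ≟ a))
      ≡⟨ ∑ₗ-elements-𝟙≡ (z zero) ⟩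
    1 ∎

  length-allVects : ∀ k → length (allVects k) ≡ card ℕ.^ k
  length-allVects k = trans (sym (ℕₚ.*-identityʳ _)) (trans (sym (∑ₗ-const (allVects k) 1)) (∑ₗ-allVects-1 k))
    where
    ∑ₗ-allVects-1 : ∀ k → ∑ₗ (allVects k) (λ _ → 1) ≡ card ℕ.^ k
    ∑ₗ-allVects-1 zero    = refl
    ∑ₗ-allVects-1 (suc k) = begin
      ∑ₗ (allVects (suc k)) (λ _ → 1)                    ≡⟨ ∑ₗ-allVects-suc k _ (λ _ → refl) ⟩
      ∑ₗ elements (λ _ → ∑ₗ (allVects k) (λ _ → 1))      ≡⟨ ∑ₗ-cong elements (λ _ → ∑ₗ-allVects-1 k) ⟩
      ∑ₗ elements (λ _ → card ℕ.^ k)                     ≡⟨ ∑ₗ-const elements _ ⟩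
      length elements ℕ.* card ℕ.^ k                     ≡⟨ cong (ℕ._* card ℕ.^ k) length-elements ⟩
      card ℕ.^ suc k                                     ∎

  countPre≡∑ₗ𝟙 : ∀ {k k̃} (g : Vect k → Vect k̃) y → countPre g y ≡ ∑ₗ (allVects k) (λ x → 𝟙 (g x ≟ᵥ y))
  countPre≡∑ₗ𝟙 {k} g y = length-filter≡∑ₗ𝟙 (λ x → g x ≟ᵥ y) (allVects k)

  ∑ₗ-countPre : ∀ {k k̃} (g : Vect k → Vect k̃) → ∑ₗ (allVects k̃) (countPre g) ≡ card ℕ.^ k
  ∑ₗ-countPre {k} {k̃} g = begin
    ∑ₗ (allVects k̃) (countPre g)                                    ≡⟨ ∑ₗ-cong (allVects k̃) (countPre≡∑ₗ𝟙 g) ⟩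
    ∑ₗ (allVects k̃) (λ y → ∑ₗ (allVects k) (λ x → 𝟙 (g x ≟ᵥ y)))
      ≡⟨ sym (∑ₗ-comm (allVects k) (allVects k̃) _) ⟩
    ∑ₗ (allVects k) (λ x → ∑ₗ (allVects k̃) (λ y → 𝟙 (g x ≟ᵥ y)))
      ≡⟨ ∑ₗ-cong (allVects k) (λ x → ∑ₗ-allVects-𝟙≐ k̃ (g x)) ⟩
    ∑ₗ (allVects k) (λ _ → 1)                                       ≡⟨ ∑ₗ-const (allVects k) 1 ⟩
    length (allVects k) ℕ.* 1                                       ≡⟨ ℕₚ.*-identityʳ _ ⟩
    length (allVects k)                                             ≡⟨ length-allVects k ⟩
    card ℕ.^ k                                                      ∎

  countPre-affine : ∀ {k k̃} (g L : Vect k → Vect k̃) →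
                    (∀ {u v} → u ≐ v → g u ≐ g v) →
                    (∀ x u → g (x +ᵥ u) ≐ g x +ᵥ L u) →
                    (∀ z → ∃ λ u → L u ≐ z) →
                    ∀ y → countPre g y ℕ.* card ℕ.^ k̃ ≡ card ℕ.^ k
  countPre-affine {k} {k̃} g L g-resp g-affine L-onto y = begin
    countPre g y ℕ.* card ℕ.^ k̃                ≡⟨ ℕₚ.*-comm (countPre g y) _ ⟩
    card ℕ.^ k̃ ℕ.* countPre g y                ≡⟨ cong (ℕ._* countPre g y) (sym (length-allVects k̃)) ⟩
    length (allVects k̃) ℕ.* countPre g y       ≡⟨ sym (∑ₗ-const (allVects k̃) _) ⟩
    ∑ₗ (allVects k̃) (λ _ → countPre g y)       ≡⟨ ∑ₗ-cong (allVects k̃) (fibres-equal y) ⟩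
    ∑ₗ (allVects k̃) (countPre g)               ≡⟨ ∑ₗ-countPre g ⟩
    card ℕ.^ k                                 ∎
    where
    fibres-equal : ∀ y y′ → countPre g y ≡ countPre g y′
    fibres-equal y y′ = begin
      countPre g y                                ≡⟨ countPre≡∑ₗ𝟙 g y ⟩
      ∑ₗ (allVects k) (λ x → 𝟙 (g x ≟ᵥ y))        ≡⟨ ∑ₗ-allVects-+ᵥ k _ 𝟙-fibre-resp u ⟩
      ∑ₗ (allVects k) (λ x → 𝟙 (g (x +ᵥ u) ≟ᵥ y))
        ≡⟨ ∑ₗ-cong (allVects k) (λ x → 𝟙-cong (shift-back x) (shift-forth x) _ _) ⟩
      ∑ₗ (allVects k) (λ x → 𝟙 (g x ≟ᵥ y′))       ≡⟨ sym (countPre≡∑ₗ𝟙 g y′) ⟩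
      countPre g y′                               ∎
      where
      𝟙-fibre-resp : Respects≐ (λ x → 𝟙 (g x ≟ᵥ y))
      𝟙-fibre-resp u≐v = 𝟙-cong (λ gu≐y i → trans (sym (g-resp u≐v i)) (gu≐y i))
                                (λ gv≐y i → trans (g-resp u≐v i) (gv≐y i)) _ _
      u = proj₁ (L-onto (λ i → y i + - y′ i))
      g[x+u] : ∀ x i → g (x +ᵥ u) i ≡ g x i + (y i + - y′ i)
      g[x+u] x i = trans (g-affine x u i) (cong (g x i +_) (proj₂ (L-onto _) i))
      y′+[y-y′]≡y : ∀ i → y′ i + (y i + - y′ i) ≡ y i
      y′+[y-y′]≡y i = trans (+-comm _ _) (x-y+y≡x (y i) (y′ i))
      shift-back : ∀ x → g (x +ᵥ u) ≐ y → g x ≐ y′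
      shift-back x g[x+u]≐y i = +-cancelʳ _ _ _ (trans (sym (g[x+u] x i)) (trans (g[x+u]≐y i) (sym (y′+[y-y′]≡y i))))
      shift-forth : ∀ x → g x ≐ y′ → g (x +ᵥ u) ≐ y
      shift-forth x gx≐y′ i = trans (g[x+u] x i) (trans (cong (_+ (y i + - y′ i)) (gx≐y′ i)) (y′+[y-y′]≡y i))

  zeroVec? : ∀ {n} (a : Vect n) → Dec (zeroVec a)
  zeroVec? a = all? (λ j → a j ≟ 0#)

  independent-or-dependent : ∀ {r n} (v : Fin r → Vect n) →
                             LinIndep v ⊎ ∃ λ a → IsRelation v a × ∃ λ j → a j ≢ 0#
  independent-or-dependent {r} v with anyₗ? nontrivial? (allVects r)
    where
    nontrivial? : ∀ a → Dec (IsRelation v a × ¬ zeroVec a)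
    nontrivial? a = all? (λ i → ∑ (λ j → a j * v j i) ≟ 0#) ×-dec ¬? (zeroVec? a)
  ... | yes some = let (a , _ , rel , a≢0) = find some in inj₂ (a , rel , ¬∀⟶∃¬ r _ (λ j → a j ≟ 0#) a≢0)
  ... | no  none = inj₁ indep
    where
    indep : LinIndep v
    indep a rel j with allVects-complete r a
    ... | u , u∈ , a≐u = trans (a≐u j) (decidable-stable (zeroVec? u) (λ u≢0 → none (lose u∈ (u-rel , u≢0))) j)
      where
      u-rel : IsRelation v u
      u-rel i = trans (∑-cong (λ j → cong (_* v j i) (sym (a≐u j)))) (rel i)

  dependent-extension : ∀ {r n} (w : Vect n) (v : Fin r → Vect n) → LinIndep v → ¬ LinIndep (w V.∷ v) →
                        ∃ λ a → IsRelation (w V.∷ v) a × a zero ≢ 0#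
  dependent-extension {r} w v v-indep ¬indep with independent-or-dependent (w V.∷ v)
  ... | inj₁ indep = ⊥-elim (¬indep indep)
  ... | inj₂ (a , rel , s , as≢0) = a , rel , λ a₀≡0 → as≢0 (all≡0 a₀≡0 s)
    where
    all≡0 : a zero ≡ 0# → ∀ s → a s ≡ 0#
    all≡0 a₀≡0 zero    = a₀≡0
    all≡0 a₀≡0 (suc t) = v-indep (a ∘ suc) (λ i → begin
      ∑ (λ t → a (suc t) * v t i)                   ≡⟨ sym (+-identityˡ _) ⟩
      0# + ∑ (λ t → a (suc t) * v t i)
        ≡⟨ cong (_+ ∑ (λ t → a (suc t) * v t i)) (sym (trans (cong (_* w i) a₀≡0) (zeroˡ (w i)))) ⟩
      a zero * w i + ∑ (λ t → a (suc t) * v t i)    ≡⟨ rel i ⟩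
      0#                                            ∎) t

  IndepCols? : ∀ {r c} (A : Mat r c) t → Dec (IndepCols A t)
  IndepCols? {c = c} A t with anyₗ? (λ σ → injective? σ ×-dec linIndep? (λ j i → A i (σ j))) (allFunctions (allFin c) t)
    where
    linIndep? : ∀ {r n} (v : Fin r → Vect n) → Dec (LinIndep v)
    linIndep? v with independent-or-dependent v
    ... | inj₁ indep = yes indep
    ... | inj₂ (a , rel , j , aj≢0) = no (λ indep → aj≢0 (indep a rel j))
  ... | yes some = let (σ , _ , σ-inj , indep) = find some in yes (σ , σ-inj , indep)
  ... | no  none = no λ (σ , σ-inj , indep) → absurd σ σ-inj indep
    where
    absurd : ∀ σ → Injective _≡_ _≡_ σ → LinIndep (λ j i → A i (σ j)) → _
    absurd σ σ-inj indep with allFunctions-complete ∈-allFin t σ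
    ... | τ , τ∈ , σ≗τ = none (lose τ∈ ((λ eq → σ-inj (trans (σ≗τ _) (trans eq (sym (σ≗τ _))))) ,
                                         LinIndep-cong (λ j i → cong (A i) (σ≗τ j)) indep))

  rank : ∀ {r c} (A : Mat r c) → ∃ (RankIs A)
  rank {c = c} A = largest (IndepCols? A) ((λ ()) , (λ {}) , (λ _ _ ())) c (λ t (_ , σ-inj , _) → injective⇒≤ σ-inj)

  RankIs-unique : ∀ {r c} {A : Mat r c} {s s′} → RankIs A s → RankIs A s′ → s ≡ s′
  RankIs-unique (indep , maximal) (indep′ , maximal′) = ℕₚ.≤-antisym (maximal′ _ indep) (maximal _ indep′)

  RankIs-cong : ∀ {r c} {A B : Mat r c} {s} → (∀ i j → A i j ≡ B i j) → RankIs A s → RankIs B s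
  RankIs-cong A≗B ((σ , σ-inj , indep) , maximal) =
    (σ , σ-inj , LinIndep-cong (λ j i → A≗B i (σ j)) indep) ,
    λ t (τ , τ-inj , indep′) → maximal t (τ , τ-inj , LinIndep-cong (λ j i → sym (A≗B i (τ j))) indep′)

module Subfield (K F : FiniteField) (ι : FiniteField.Carrier K → FiniteField.Carrier F)
                (emb : Setting.IsEmbedding K F ι) {m : ℕ}
                (φ : FiniteField.Carrier F → FiniteField.Vect K m) (iso : Setting.IsLinIso K F ι φ) where
  open import Data.Nat as ℕ using (ℕ; zero; suc; _+_; _≤_; _<_; _∸_)
  import Data.Nat.Properties as ℕₚ
  open import Data.Fin using (Fin; zero; suc; _↑ˡ_; _↑ʳ_; inject≤; fromℕ<)
  open import Data.Fin.Properties using (inject≤-injective)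
  open import Data.List using (length)
  open import Data.Product using (∃; _×_; _,_; proj₁; proj₂)
  open import Data.Sum using (inj₁; inj₂)
  open import Data.Empty using (⊥-elim)
  import Data.Vec.Functional as V
  open import Data.Vec.Functional.Properties using (lookup-++ˡ; lookup-++ʳ)
  open import Function using (_∘_)
  open import Function.Definitions using (Injective)
  open import Relation.Nullary using (¬_; yes; no; ¬?)
  open import Relation.Nullary.Decidable using (decidable-stable)
  open import Relation.Binary.PropositionalEquality
  open ListSums
  open FiniteSearch

  private
    module K = FiniteField K
    module F = FiniteField F
    module KL = LinearAlgebra K
    module FL = LinearAlgebra F
  open Setting.IsEmbedding emb
  open Setting.IsLinIso iso
  open Setting.WithPhi K F ι φ
  open ≡-Reasoning

  ι-0 : ι K.0# ≡ F.0#
  ι-0 = FL.+-identityˡ-unique (ι K.0#) (ι K.0#) (trans (sym (hom-+ K.0# K.0#)) (cong ι (KL.+-identityʳ K.0#)))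

  ι-∑ : ∀ {n} (f : K.Vect n) → ι (K.∑ f) ≡ F.∑ (ι ∘ f)
  ι-∑ {zero}  f = ι-0
  ι-∑ {suc n} f = trans (hom-+ _ _) (cong (ι (f zero) F.+_) (ι-∑ (f ∘ suc)))

  φ-0 : ∀ i → φ F.0# i ≡ K.0#
  φ-0 i = KL.+-identityˡ-unique _ _ (trans (sym (lin-+ F.0# F.0# i)) (cong (λ x → φ x i) (FL.+-identityʳ F.0#)))

  φ-∑ : ∀ {n} (f : F.Vect n) i → φ (F.∑ f) i ≡ K.∑ (λ j → φ (f j) i)
  φ-∑ {zero}  f i = φ-0 i
  φ-∑ {suc n} f i = trans (lin-+ _ _ i) (cong (φ (f zero) i K.+_) (φ-∑ (f ∘ suc) i))

  φ-∙ι : ∀ {n} (c : F.Vect n) (a : K.Vect n) i → φ (c FL.∙ (ι ∘ a)) i ≡ Φ c i KL.∙ a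
  φ-∙ι {n} c a i = trans (φ-∑ (λ j → c j F.* ι (a j)) i) (KL.∑-cong {n} λ j → begin
    φ (c j F.* ι (a j)) i   ≡⟨ cong (λ x → φ x i) (FL.*-comm (c j) (ι (a j))) ⟩
    φ (ι (a j) F.* c j) i   ≡⟨ lin-* (a j) (c j) i ⟩
    a j K.* φ (c j) i       ≡⟨ KL.*-comm (a j) _ ⟩
    φ (c j) i K.* a j       ∎)

  ιᴹ : ∀ {r c} → K.Mat r c → F.Mat r c
  ιᴹ A i j = ι (A i j)

  ι-LinIndep⇒LinIndep : ∀ {k n} (A : K.Mat k n) → F.LinIndep (ιᴹ A) → K.LinIndep A
  ι-LinIndep⇒LinIndep {k} A indep μ rel l = inj (trans (indep (ι ∘ μ) ι-rel l) (sym ι-0))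
    where
    ι-rel : ∀ j → F.∑ (λ l → ι (μ l) F.* ι (A l j)) ≡ F.0#
    ι-rel j = begin
      F.∑ (λ l → ι (μ l) F.* ι (A l j)) ≡⟨ FL.∑-cong {k} (λ l → sym (hom-* (μ l) (A l j))) ⟩
      F.∑ (λ l → ι (μ l K.* A l j))     ≡⟨ sym (ι-∑ (λ l → μ l K.* A l j)) ⟩
      ι (K.∑ (λ l → μ l K.* A l j))     ≡⟨ cong ι (rel j) ⟩
      ι K.0#                            ≡⟨ ι-0 ⟩
      F.0#                              ∎

  infix 4 _⊥_
  _⊥_ : ∀ {k n} → F.Vect n → K.Mat k n → Set
  c ⊥ A = ∀ l → c FL.∙ ιᴹ A l ≡ F.0#

  ⊥⇒Φ-⊥ : ∀ {k n} (c : F.Vect n) (A : K.Mat k n) → c ⊥ A → ∀ i l → Φ c i KL.∙ A l ≡ K.0#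
  ⊥⇒Φ-⊥ c A c⊥A i l = trans (sym (φ-∙ι c (A l) i)) (trans (cong (λ x → φ x i) (c⊥A l)) (φ-0 i))

  -- The rows of A and the unit vectors at r independent column positions of Φ(c) are k + r
  -- independent vectors of F_qⁿ: paired with the rows of Φ(c), a relation among them becomes
  -- a relation among those columns, since the part coming from A pairs to zero as c ⊥ A.
  LinIndep-rows+rank≤ : ∀ {k n r} (A : K.Mat k n) (c : F.Vect n) → K.LinIndep A → c ⊥ A →
                        RankQ c r → k + r ≤ n
  LinIndep-rows+rank≤ {k} {n} {r} A c A-indep c⊥A ((σ , _ , cols-indep) , _) =
    KL.LinIndep⇒≤ {v = rows} rows-indep
    where
    rows : Fin (k + r) → K.Vect n
    rows = A V.++ (KL.e ∘ σ)
    rows-indep : K.LinIndep rows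
    rows-indep a rel = ↑-cases μ≡0 ν≡0
      where
      μ : K.Vect k
      μ l = a (l ↑ˡ r)
      ν : K.Vect r
      ν t = a (k ↑ʳ t)
      R S : K.Vect n
      R = μ K.·ᵣ A
      S = KL.placeAt σ ν
      R+S≡0 : ∀ j → R j K.+ S j ≡ K.0#
      R+S≡0 j = trans (sym (trans (KL.∑-++ {k} {r} (λ s → a s K.* rows s j))
                  (cong₂ K._+_ (KL.∑-cong {k} (λ l → cong (λ v → μ l K.* v j) (lookup-++ˡ A (KL.e ∘ σ) l)))
                               (KL.∑-cong {r} (λ t → cong (λ v → ν t K.* v j) (lookup-++ʳ A (KL.e ∘ σ) t))))))
                (rel j)
      S≡-R : ∀ j → S j ≡ K.- R j
      S≡-R j = KL.+-inverseʳ-unique (R j) (S j) (R+S≡0 j)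
      R-on-Φc : ∀ i → R KL.∙ Φ c i ≡ K.0#
      R-on-Φc i = trans (KL.∙-comm R (Φ c i)) (trans (KL.∙-·ᵣ (Φ c i) μ A)
                    (KL.∑-zero {k} (λ l → trans (cong (μ l K.*_) (⊥⇒Φ-⊥ c A c⊥A i l)) (KL.zeroʳ (μ l)))))
      ν≡0 : ∀ t → ν t ≡ K.0#
      ν≡0 = cols-indep ν λ i → begin
        K.∑ (λ t → ν t K.* Φ c i (σ t))     ≡⟨ sym (KL.∑-placeAt* σ ν (Φ c i)) ⟩
        S KL.∙ Φ c i                        ≡⟨ KL.∑-cong {n} (λ j → trans (cong (K._* Φ c i j) (S≡-R j))
                                                                        (sym (KL.-‿distribˡ-* _ _))) ⟩
        K.∑ (λ j → K.- (R j K.* Φ c i j))   ≡⟨ sym (KL.-‿distrib-∑ {n} _) ⟩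
        K.- (R KL.∙ Φ c i)                  ≡⟨ cong K.-_ (R-on-Φc i) ⟩
        K.- K.0#                            ≡⟨ KL.-0#≈0# ⟩
        K.0#                                ∎
      μ≡0 : ∀ l → μ l ≡ K.0#
      μ≡0 = A-indep μ λ j → begin
        R j            ≡⟨ sym (KL.+-identityʳ (R j)) ⟩
        R j K.+ K.0#   ≡⟨ cong (R j K.+_) (sym (KL.∑-zero {r} (λ t → trans (cong (K._* _) (ν≡0 t)) (KL.zeroˡ _)))) ⟩
        R j K.+ S j    ≡⟨ R+S≡0 j ⟩
        K.0#           ∎

  codeword-⊥-LinIndep⇒zero : ∀ {n k̃ k d} (G : F.Mat k̃ n) → MinRankDistIs G d → n < k + d →
                              (A : K.Mat k n) → K.LinIndep A → (a : F.Vect k̃) →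
                              (a F.·ᵣ G) ⊥ A → F.zeroVec (a F.·ᵣ G)
  codeword-⊥-LinIndep⇒zero {k = k} G (_ , minimal) n<k+d A A-indep a aG⊥A
    with FL.zeroVec? (a F.·ᵣ G)
  ... | yes aG≡0 = aG≡0
  ... | no  aG≢0 = ⊥-elim (ℕₚ.<⇒≱ n<k+d (ℕₚ.≤-trans (ℕₚ.+-monoʳ-≤ k (minimal a aG≢0 r rank-r))
                                                     (LinIndep-rows+rank≤ A (a F.·ᵣ G) A-indep aG⊥A rank-r)))
    where
    r      = proj₁ (KL.rank (Φ (a F.·ᵣ G)))
    rank-r = proj₂ (KL.rank (Φ (a F.·ᵣ G)))

  code⇒extractor : ∀ {n k̃ d} (G : F.Mat k̃ n) → GeneratesRankCode G d →
                   IsZeroErrorExtractor (suc n ∸ d) (G F.·ᶜ_)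
  code⇒extractor {n} {k̃} {d} G (G-indep , G-dist) A β ιA-indep =
    FL.countPre-affine g L g-resp g-affine L-onto
    where
    k = suc n ∸ d
    g L : F.Vect k → F.Vect k̃
    g x = G F.·ᶜ ((x F.·ᵣ ιᴹ A) F.+ᵥ β)
    L u = G F.·ᶜ (u F.·ᵣ ιᴹ A)
    g-resp : ∀ {u v} → u FL.≐ v → g u FL.≐ g v
    g-resp u≐v i = FL.∑-cong {n} λ j →
      cong (λ z → G i j F.* (z F.+ β j)) (FL.∑-cong {k} (λ l → cong (F._* ι (A l j)) (u≐v l)))
    g-affine : ∀ x u → g (x F.+ᵥ u) FL.≐ g x F.+ᵥ L u
    g-affine x u i = trans
      (FL.∑-cong {n} λ j → cong (G i j F.*_) (trans (cong (F._+ β j) (FL.·ᵣ-+ᵥ x u (ιᴹ A) j)) (FL.+-exchange′ _ _ _)))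
      (FL.∙-+ᵥ (G i) _ _)
    B : F.Mat k̃ k
    B i l = G i FL.∙ ιᴹ A l
    B-indep : F.LinIndep B
    B-indep a rel = G-indep a (codeword-⊥-LinIndep⇒zero G G-dist n<k+d A (ι-LinIndep⇒LinIndep A ιA-indep) a
                                 (λ l → trans (sym (FL.∙-·ᶜ a G (ιᴹ A l))) (rel l)))
      where
      n<k+d : n < k + d
      n<k+d = ℕₚ.≤-trans (ℕₚ.m≤n+m∸n (suc n) d) (ℕₚ.≤-reflexive (ℕₚ.+-comm d k))
    L-onto : ∀ z → ∃ λ u → L u FL.≐ z
    L-onto z = let (u , Bu≐z) = FL.·ᶜ-onto B B-indep z in
      u , λ i → trans (trans (FL.∙-·ᵣ (G i) u (ιᴹ A)) (FL.∑-cong {k} (λ l → FL.*-comm (u l) (B i l)))) (Bu≐z i)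

  minimumRankDistance : ∀ {k̃ n} (M : F.Mat k̃ n) (y₀ : F.Vect k̃) → ¬ F.zeroVec (y₀ F.·ᵣ M) →
                        ∃ (MinRankDistIs M)
  minimumRankDistance {k̃} M y₀ y₀M≢0 = rk y* , (y* , y*M≢0 , rank-of y*) , minimal′
    where
    rank-of : ∀ y → RankQ (y F.·ᵣ M) (proj₁ (KL.rank (Φ (y F.·ᵣ M))))
    rank-of y = proj₂ (KL.rank (Φ (y F.·ᵣ M)))
    rk : F.Vect k̃ → ℕ
    rk y = proj₁ (KL.rank (Φ (y F.·ᵣ M)))
    found = minimum rk (λ y → ¬? (FL.zeroVec? (y F.·ᵣ M))) (F.allVects k̃) y₀M≢0
    y* = proj₁ found
    y*M≢0 = proj₁ (proj₂ found)
    minimal′ : ∀ y → ¬ F.zeroVec (y F.·ᵣ M) → ∀ r → RankQ (y F.·ᵣ M) r → rk y* ≤ r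
    minimal′ y yM≢0 r rank-r = ℕₚ.≤-trans (proj₂ (proj₂ found) y′∈ y′M≢0) (ℕₚ.≤-reflexive rk-y′≡r)
      where
      y′ = proj₁ (FL.allVects-complete k̃ y)
      y′∈ = proj₁ (proj₂ (FL.allVects-complete k̃ y))
      yM≐y′M : ∀ j → (y F.·ᵣ M) j ≡ (y′ F.·ᵣ M) j
      yM≐y′M j = FL.∑-cong {k̃} (λ i → cong (F._* M i j) (proj₂ (proj₂ (FL.allVects-complete k̃ y)) i))
      y′M≢0 : ¬ F.zeroVec (y′ F.·ᵣ M)
      y′M≢0 y′M≡0 = yM≢0 (λ j → trans (yM≐y′M j) (y′M≡0 j))
      rk-y′≡r : rk y′ ≡ r
      rk-y′≡r = KL.RankIs-unique {A = Φ (y′ F.·ᵣ M)} (rank-of y′)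
                  (KL.RankIs-cong {A = Φ (y F.·ᵣ M)} (λ i j → cong (λ z → φ z i) (yM≐y′M j)) rank-r)

  module _ {n k̃ k} (M : F.Mat k̃ n) (extractor : IsZeroErrorExtractor k (M F.·ᶜ_)) where

    extractor⇒onto : (A : K.Mat k n) → F.LinIndep (ιᴹ A) →
                     ∀ z → ∃ λ x → M F.·ᶜ ((x F.·ᵣ ιᴹ A) F.+ᵥ (λ _ → F.0#)) FL.≐ z
    extractor⇒onto A ιA-indep z = filter-nonempty (λ x → _ F.≟ᵥ z) (F.allVects k) λ count≡0 →
      ℕₚ.<⇒≢ (ℕₚ.<-trans ℕₚ.0<1+n FL.2≤card)
             (sym (ℕₚ.m^n≡0⇒m≡0 F.card k (trans (sym (extractor A (λ _ → F.0#) ιA-indep z)) (cong (ℕ._* _) count≡0))))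

    extractor-⊥⇒zero : (A : K.Mat k n) → F.LinIndep (ιᴹ A) → (y : F.Vect k̃) → (y F.·ᵣ M) ⊥ A → F.zeroVec y
    extractor-⊥⇒zero A ιA-indep y yM⊥A p = begin
      y p                                                ≡⟨ sym (FL.∑-*e y p) ⟩
      y FL.∙ FL.e p                                      ≡⟨ FL.∑-cong {k̃} (λ i → cong (y i F.*_) (sym (Mw≐e i))) ⟩
      y FL.∙ (M F.·ᶜ w)                                  ≡⟨ FL.∙-·ᶜ y M w ⟩
      (y F.·ᵣ M) FL.∙ w                                  ≡⟨ FL.∙-+ᵥ-zero (y F.·ᵣ M) (x F.·ᵣ ιᴹ A) ⟩
      (y F.·ᵣ M) FL.∙ (x F.·ᵣ ιᴹ A)                      ≡⟨ FL.∙-·ᵣ (y F.·ᵣ M) x (ιᴹ A) ⟩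
      F.∑ (λ l → x l F.* ((y F.·ᵣ M) FL.∙ ιᴹ A l))
        ≡⟨ FL.∑-zero {k} (λ l → trans (cong (x l F.*_) (yM⊥A l)) (FL.zeroʳ (x l))) ⟩
      F.0#                                               ∎
      where
      x = proj₁ (extractor⇒onto A ιA-indep (FL.e p))
      Mw≐e = proj₂ (extractor⇒onto A ιA-indep (FL.e p))
      w = (x F.·ᵣ ιᴹ A) F.+ᵥ (λ _ → F.0#)

    -- A 0-dimensional source is a single point, so the output cannot be uniform on F^k̃.
    extractor⇒dim≢0 : 1 ≤ k̃ → k ≢ 0
    extractor⇒dim≢0 1≤k̃ refl
      with ℕₚ.m^n≡1⇒n≡0∨m≡1 F.card k̃ (ℕₚ.m*n≡1⇒n≡1 (F.countPre constant (λ _ → F.0#)) _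
                                        (extractor (λ ()) (λ _ → F.0#) (λ _ _ ()) (λ _ → F.0#)))
      where
      constant : F.Vect 0 → F.Vect k̃
      constant x = M F.·ᶜ ((x F.·ᵣ ιᴹ (λ ())) F.+ᵥ (λ _ → F.0#))
    ... | inj₁ k̃≡0    = ℕₚ.<⇒≢ 1≤k̃ (sym k̃≡0)
    ... | inj₂ card≡1 = ℕₚ.<⇒≢ FL.2≤card (sym card≡1)

  module _ (card-F : F.card ≡ K.card ℕ.^ m) where

    -- ψ is not known to respect pointwise equality of vectors, so ψ ∘ φ = id alone does not
    -- make φ injective.  Count instead: every fibre of φ is nonempty (it contains ψ v) and the
    -- |K|ᵐ = |F| fibres partition F, so none has two elements.
    φ-injective₀ : ∀ x → (∀ i → φ x i ≡ K.0#) → x ≡ F.0#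
    φ-injective₀ x φx≡0 with x F.≟ F.0#
    ... | yes x≡0 = x≡0
    ... | no  x≢0 = ⊥-elim (ℕₚ.<-irrefl ∑fibres≡length (length<∑ₗ fibre≥1 u₀∈ fibre-u₀≥2))
      where
      fibre : K.Vect m → ℕ
      fibre v = ∑ₗ F.elements (λ z → 𝟙 (φ z K.≟ᵥ v))
      ∑fibres≡length : length (K.allVects m) ≡ ∑ₗ (K.allVects m) fibre
      ∑fibres≡length = begin
        length (K.allVects m)                                         ≡⟨ KL.length-allVects m ⟩
        K.card ℕ.^ m                                                  ≡⟨ sym card-F ⟩
        F.card                                                        ≡⟨ sym FL.length-elements ⟩
        length F.elements                                             ≡⟨ sym (ℕₚ.*-identityʳ _) ⟩
        length F.elements ℕ.* 1                                       ≡⟨ sym (∑ₗ-const F.elements 1) ⟩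
        ∑ₗ F.elements (λ _ → 1)
          ≡⟨ sym (∑ₗ-cong F.elements (λ z → KL.∑ₗ-allVects-𝟙≐ m (φ z))) ⟩
        ∑ₗ F.elements (λ z → ∑ₗ (K.allVects m) (λ v → 𝟙 (φ z K.≟ᵥ v)))
          ≡⟨ ∑ₗ-comm F.elements (K.allVects m) _ ⟩
        ∑ₗ (K.allVects m) fibre                                       ∎
      fibre≥1 : ∀ v → 1 ≤ fibre v
      fibre≥1 v = ℕₚ.≤-trans (ℕₚ.≤-reflexive (sym (FL.∑ₗ-elements-𝟙≡ (ψ v))))
                             (∑ₗ-mono-≤ F.elements (λ z → 𝟙-mono (λ { refl → φψ v }) (ψ v F.≟ z) (φ z K.≟ᵥ v)))
      u₀ = proj₁ (KL.allVects-complete m (λ _ → K.0#))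
      u₀∈ = proj₁ (proj₂ (KL.allVects-complete m (λ _ → K.0#)))
      0≐u₀ = proj₂ (proj₂ (KL.allVects-complete m (λ _ → K.0#)))
      fibre-u₀≥2 : 2 ≤ fibre u₀
      fibre-u₀≥2 = ℕₚ.≤-trans (ℕₚ.≤-reflexive (sym (trans (∑ₗ-distrib-+ F.elements _ _)
                                                        (cong₂ ℕ._+_ (FL.∑ₗ-elements-𝟙≡ x) (FL.∑ₗ-elements-𝟙≡ F.0#)))))
                              (∑ₗ-mono-≤ F.elements (λ z → 𝟙-+-≤
                                 (λ { refl i → trans (φx≡0 i) (0≐u₀ i) })
                                 (λ { refl i → trans (φ-0 i) (0≐u₀ i) })
                                 (λ x≡z 0≡z → x≢0 (trans x≡z (sym 0≡z)))
                                 (x F.≟ z) (F.0# F.≟ z) (φ z K.≟ᵥ u₀)))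

    LinIndep⇒ι-LinIndep : ∀ {k n} (A : K.Mat k n) → K.LinIndep A → F.LinIndep (ιᴹ A)
    LinIndep⇒ι-LinIndep {k} A indep μ rel l = φ-injective₀ (μ l) (λ i → indep (λ l → φ (μ l) i) (K-rel i) l)
      where
      K-rel : ∀ i j → K.∑ (λ l → φ (μ l) i K.* A l j) ≡ K.0#
      K-rel i j = begin
        K.∑ (λ l → φ (μ l) i K.* A l j)      ≡⟨ sym (φ-∙ι μ (λ l → A l j) i) ⟩
        φ (F.∑ (λ l → μ l F.* ι (A l j))) i  ≡⟨ cong (λ z → φ z i) (rel j) ⟩
        φ F.0# i                             ≡⟨ φ-0 i ⟩
        K.0#                                 ∎

    -- For each l the columns of Φ(c) at τ l, σ 0, …, σ (r-1) are dependent, as Φ(c) has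
    -- rank r; the coefficients of such a dependency, placed at those positions, form row l
    -- of A.  It is orthogonal to c, and its only nonzero entry among the positions τ is at τ l.
    annihilator : ∀ {n r k} (c : F.Vect n) → RankQ c r → r + k ≤ n →
                  ∃ λ (A : K.Mat k n) → K.LinIndep A × c ⊥ A
    annihilator {n} {r} {k} c ((σ , σ-inj , σ-indep) , maximal) r+k≤n =
      A , KL.LinIndep-diagonal A τ A-diagonal≢0 A-off-diagonal≡0 , c⊥A
      where
      τ = proj₁ (injection-avoiding k σ r+k≤n)
      τ-inj = proj₁ (proj₂ (injection-avoiding k σ r+k≤n))
      τ∉σ = proj₂ (proj₂ (injection-avoiding k σ r+k≤n))
      positions : Fin k → Fin (suc r) → Fin n
      positions l = τ l V.∷ σ
      positions-inj : ∀ l → Injective _≡_ _≡_ (positions l)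
      positions-inj l {zero}  {zero}  _  = refl
      positions-inj l {zero}  {suc t} eq = ⊥-elim (τ∉σ l t eq)
      positions-inj l {suc t} {zero}  eq = ⊥-elim (τ∉σ l t (sym eq))
      positions-inj l {suc t} {suc u} eq = cong suc (σ-inj eq)
      column : Fin n → K.Vect m
      column j i = Φ c i j
      relation : ∀ l → ∃ λ a → KL.IsRelation (column ∘ positions l) a × a zero ≢ K.0#
      relation l = KL.dependent-extension (column (τ l)) (column ∘ σ) σ-indep
                     (λ indep → ℕₚ.1+n≰n (maximal (suc r) (positions l , positions-inj l , indep)))
      a : Fin k → Fin (suc r) → K.Carrier
      a l = proj₁ (relation l)
      A : K.Mat k n
      A l = KL.placeAt (positions l) (a l)
      A-at-τ : ∀ l l₀ → A l (τ l₀) ≡ a l zero K.* KL.e (τ l) (τ l₀)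
      A-at-τ l l₀ = KL.∑-supported (λ s → a l s K.* KL.e (positions l s) (τ l₀)) zero λ where
        zero    0≢0 → ⊥-elim (0≢0 refl)
        (suc t) _   → trans (cong (a l (suc t) K.*_) (KL.e-offdiag (τ∉σ l₀ t))) (KL.zeroʳ _)
      A-diagonal≢0 : ∀ l → A l (τ l) ≢ K.0#
      A-diagonal≢0 l A≡0 = proj₂ (proj₂ (relation l))
        (trans (sym (trans (cong (a l zero K.*_) (KL.e-diag (τ l))) (KL.*-identityʳ _))) (trans (sym (A-at-τ l l)) A≡0))
      A-off-diagonal≡0 : ∀ l l₀ → l ≢ l₀ → A l (τ l₀) ≡ K.0#
      A-off-diagonal≡0 l l₀ l≢l₀ =
        trans (A-at-τ l l₀) (trans (cong (a l zero K.*_) (KL.e-offdiag (l≢l₀ ∘ τ-inj ∘ sym))) (KL.zeroʳ _))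
      c⊥A : c ⊥ A
      c⊥A l = φ-injective₀ _ λ i → begin
        φ (c FL.∙ ιᴹ A l) i                           ≡⟨ trans (φ-∙ι c (A l) i) (KL.∙-comm (Φ c i) (A l)) ⟩
        K.∑ (λ j → A l j K.* Φ c i j)                 ≡⟨ KL.∑-placeAt* (positions l) (a l) (Φ c i) ⟩
        K.∑ (λ s → a l s K.* Φ c i (positions l s))   ≡⟨ proj₁ (proj₂ (relation l)) i ⟩
        K.0#                                          ∎

    extractor⇒rank≥ : ∀ {n k̃ d} (M : F.Mat k̃ n) → IsZeroErrorExtractor (suc n ∸ d) (M F.·ᶜ_) → d ≤ n →
                      ∀ y → ¬ F.zeroVec (y F.·ᵣ M) → ∀ r → RankQ (y F.·ᵣ M) r → d ≤ r
    extractor⇒rank≥ {n} {k̃} {d} M extractor d≤n y yM≢0 r rank-r with d ℕ.≤? r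
    ... | yes d≤r = d≤r
    ... | no  d≰r = ⊥-elim (yM≢0 λ j → FL.∑-zero {k̃} (λ i → trans (cong (F._* M i j) (y≡0 i)) (FL.zeroˡ _)))
      where
      r<d = ℕₚ.≰⇒> d≰r
      r+k≤n : r + (suc n ∸ d) ≤ n
      r+k≤n = ℕₚ.≤-trans (ℕₚ.+-monoʳ-≤ r (ℕₚ.∸-monoʳ-≤ (suc n) r<d))
                         (ℕₚ.≤-reflexive (ℕₚ.m+[n∸m]≡n (ℕₚ.<⇒≤ (ℕₚ.<-≤-trans r<d d≤n))))
      annihilating = annihilator (y F.·ᵣ M) rank-r r+k≤n
      A = proj₁ annihilating
      y≡0 : F.zeroVec y
      y≡0 = extractor-⊥⇒zero M extractor A (LinIndep⇒ι-LinIndep A (proj₁ (proj₂ annihilating))) y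
                             (proj₂ (proj₂ annihilating))

    extractor⇒code : ∀ {n k̃ d} (M : F.Mat k̃ n) → 1 ≤ k̃ → 1 ≤ d → IsZeroErrorExtractor (suc n ∸ d) (M F.·ᶜ_) →
                     ∃ λ d′ → d ≤ d′ × GeneratesRankCode M d′
    extractor⇒code {n} {k̃} {d} M 1≤k̃ 1≤d extractor =
      d′ , extractor⇒rank≥ M extractor d≤n y* y*M≢0 d′ rank-y* , M-indep , distance
      where
      d≤n : d ≤ n
      d≤n = decidable-stable (d ℕ.≤? n) λ d≰n →
              extractor⇒dim≢0 M extractor 1≤k̃ (ℕₚ.m≤n⇒m∸n≡0 (ℕₚ.≰⇒> d≰n))
      k≤n : suc n ∸ d ≤ n
      k≤n = ℕₚ.∸-monoʳ-≤ (suc n) 1≤d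
      E : K.Mat (suc n ∸ d) n
      E l = KL.e (inject≤ l k≤n)
      M-indep : F.LinIndep M
      M-indep y yM≡0 = extractor-⊥⇒zero M extractor E
        (LinIndep⇒ι-LinIndep E (KL.LinIndep-diagonal E (λ l → inject≤ l k≤n)
           (λ l E≡0 → K.1≢0 (trans (sym (KL.e-diag (inject≤ l k≤n))) E≡0))
           (λ l l₀ l≢l₀ → KL.e-offdiag (l≢l₀ ∘ sym ∘ inject≤-injective k≤n k≤n _ _)))) y
        (λ l → FL.∑-zero {n} (λ j → trans (cong (F._* _) (yM≡0 j)) (FL.zeroˡ _)))
      p₀ : Fin k̃
      p₀ = fromℕ< 1≤k̃
      e-p₀M≢0 : ¬ F.zeroVec (FL.e p₀ F.·ᵣ M)
      e-p₀M≢0 e-p₀M≡0 = F.1≢0 (trans (sym (FL.e-diag p₀)) (M-indep (FL.e p₀) e-p₀M≡0 p₀))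
      d′ = proj₁ (minimumRankDistance M (FL.e p₀) e-p₀M≢0)
      distance = proj₂ (minimumRankDistance M (FL.e p₀) e-p₀M≢0)
      y* = proj₁ (proj₁ distance)
      y*M≢0 = proj₁ (proj₂ (proj₁ distance))
      rank-y* = proj₂ (proj₂ (proj₁ distance))

theorem3p10 :
    (q m : ℕ) → IsPrimePower q → 1 ≤ m →
    (K F : FiniteField) →
    FiniteField.card K ≡ q → FiniteField.card F ≡ q ^ m →
    (ι : FiniteField.Carrier K → FiniteField.Carrier F) → Setting.IsEmbedding K F ι →
    (φ : FiniteField.Carrier F → FiniteField.Vect K m) → Setting.IsLinIso K F ι φ →
    (n k̃ d : ℕ) →
    ((G : FiniteField.Mat F k̃ n) →
       Setting.WithPhi.GeneratesRankCode K F ι φ G d →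
       Setting.WithPhi.IsZeroErrorExtractor K F ι φ (suc n ∸ d)
         (λ x → FiniteField._·ᶜ_ F G x))
    ×
    ((M : FiniteField.Mat F k̃ n) → 1 ≤ k̃ → 1 ≤ d →
       Setting.WithPhi.IsZeroErrorExtractor K F ι φ (suc n ∸ d)
         (λ x → FiniteField._·ᶜ_ F M x) →
       Σ ℕ λ d′ → d ≤ d′ × Setting.WithPhi.GeneratesRankCode K F ι φ M d′)
theorem3p10 q m _ _ K F card-K card-F ι emb φ iso n k̃ d =
  code⇒extractor , extractor⇒code (trans card-F (cong (_^ m) (sym card-K)))
  where open Subfield K F ι emb φ iso
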